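{- Let $n\ge2$, $m\ge1$, let $\lambda$ be an $n$-core with level numbers $(b_0,\dots,b_{n-1})$, and suppose $\Psi(\lambda)$ is the $m$-minimal alcove of a dominant region $R$ of the $m$-Shi arrangement for which $H_{\theta,m}$ is a separating wall. Then $r(R)=m+\sum_{i=2}^{n-1}b_i=\ell(\lambda)$ and $c(R)=m+\sum_{i=2}^{n-1}(m-1-b_i)=\lambda_1$.
   Context: Let $e_1,\dots,e_n$ be the standard basis of $\mathbb R^n$ with the standard inner product $\langle\cdot,\cdot\rangle$, and $V=\{(a_1,\dots,a_n)\in\mathbb R^n:\sum_i a_i=0\}$. For $1\le i\le j\le n-1$ let $\alpha_{ij}=e_i-e_{j+1}$, $\alpha_i=\alpha_{ii}$, $\Delta^+=\{\alpha_{ij}\}$, $\theta=\alpha_{1,n-1}$. For $\alpha\in\Delta^+$, $k\in\mathbb Z$, let $H_{\alpha,k}=\{v\in V:\langle v,\alpha\rangle=k\}$. The $m$-Shi arrangement is $\{H_{\alpha,k}:\alpha\in\Delta^+,\,-m<k\le m\}$; its regions are the connected components of the complement of the union of its hyperplanes, and a region is dominant if it lies in $\{v\in V:\langle v,\alpha_i\rangle\ge0\ \forall i\}$. Alcoves are the connected components of $V\setminus\bigcup_{\alpha\in\Delta^+,k\in\mathbb Z}H_{\alpha,k}$; the fundamental alcove $A_0$ is the interior of $\{v\in V:\langle v,\theta\rangle\le1,\ \langle v,\alpha_i\rangle\ge0\ \forall i\}$. Each region contains a unique alcove separated from $A_0$ by the fewest hyperplanes $H_{\alpha,k}$ ($k\in\mathbb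 Z$), its $m$-minimal alcove. A wall of a region $R$ is a hyperplane of the $m$-Shi arrangement supporting a facet of $R$; it is a separating wall if $R$ and $A_0$ lie in different closed half-spaces determined by it. Two sets are separated by a hyperplane if they lie in different closed half-spaces of it. Statistics: $r(R)$ is the number of pairs $(j,k)$ with $1\le j\le n-1$, $1\le k\le m$ such that $H_{\alpha_{1j},k}$ separates $R$ from $A_0$; $c(R)$ is the number of pairs $(i,k)$ with $1\le i\le n-1$, $1\le k\le m$ such that $H_{\alpha_{i,n-1},k}$ separates $R$ from $A_0$. An alcove's Shi coordinates are the integers $k_{ij}$ with $k_{ij}<\langle x,\alpha_{ij}\rangle<k_{ij}+1$ on the alcove; an alcove is determined by them. An $n$-core is a partition with no hook length divisible by $n$; $\lambda_1$ is its largest part and $\ell(\lambda)$ its number of positive parts. For an $n$-core $\lambda$, let $B=\{h^\lambda_{k1}:1\le k\le\ell(\lambda)\}\cup\mathbb Z_{<0}$ (first-column hook lengths together with the negative integers) and for $0\le i\le n-1$ let the level number $b_i$ be the least integer $q$ with $qn+i\notin B$. Put $\tilde p_i=b_{i-1}n+i-1$ ($1\le i\le n$), let $p_1<\dots<p_n$ be these in increasing order, and let $\Psi(\lambda)$ be the alcove with Shi coordinates $k_{ij}=\lfloor(p_{j+1}-p_i)/n\rfloor$; $\Psi$ is a bijection from $n$-cores onto dominant alcoves.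
   Formalization: Points of V have rational rather than real coordinates, so the regions, alcoves and walls of the $m$-Shi arrangement consist of rational points. -}

module Defs where

open import Data.Nat as ℕ using (ℕ; zero; suc; _∸_; _≤?_; _<?_)
open import Data.Nat.Properties using (≤-decTotalOrder)
open import Data.Nat.Divisibility using (_∣_)
open import Data.Nat.DivMod using (_/_)
open import Data.Integer as ℤ using (ℤ; +_; ∣_∣)
open import Data.Rational as ℚ using (ℚ)
open import Data.List using (List; []; _∷_; length; filter; map; upTo; foldr; applyUpTo)
open import Data.List.Membership.Propositional using (_∈_)
open import Data.List.Relation.Unary.All using (All)
open import Data.List.Relation.Binary.Pointwise using (Pointwise)
open import Data.List.Relation.Unary.Sorted.TotalOrder using (Sorted)
open import Data.Bool using (Bool; true; false; if_then_else_)
open import Data.Product using (Σ; _×_; ∃; _,_)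
open import Relation.Binary.PropositionalEquality using (_≡_; _≢_)
open import Relation.Nullary using (¬_; does)
import Data.List.Sort

nth : List ℕ → ℕ → ℕ
nth []       _       = 0
nth (x ∷ xs) zero    = x
nth (x ∷ xs) (suc i) = nth xs i

-- [lo, lo+1, ..., hi]  (empty if hi < lo)
range : ℕ → ℕ → List ℕ
range lo hi = applyUpTo (λ t → lo ℕ.+ t) (suc hi ∸ lo)

sumℕ : List ℕ → ℕ
sumℕ = foldr ℕ._+_ 0

sumℤ : List ℤ → ℤ
sumℤ = foldr ℤ._+_ (+ 0)

sumℚ : List ℚ → ℚ
sumℚ = foldr ℚ._+_ ℚ.0ℚ

ℤ→ℚ : ℤ → ℚ
ℤ→ℚ k = k ℚ./ 1

floorDiv : ℕ → ℕ → ℕ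
floorDiv a zero    = 0
floorDiv a (suc n) = a / suc n

data Decreasing : List ℕ → Set where
  dec[]  : Decreasing []
  dec[x] : ∀ {x} → Decreasing (x ∷ [])
  dec∷   : ∀ {x y ys} → y ℕ.≤ x → Decreasing (y ∷ ys) → Decreasing (x ∷ y ∷ ys)

IsPartition : List ℕ → Set
IsPartition la = Decreasing la × All (λ x → 1 ℕ.≤ x) la

len : List ℕ → ℕ
len = length

largestPart : List ℕ → ℕ
largestPart []      = 0
largestPart (x ∷ _) = x

conjPart : List ℕ → ℕ → ℕ
conjPart la j = length (filter (λ x → j <? x) la)

-- hook length of the cell in row i, column j (both 0-based), for
-- cells i < ℓ(λ), j < λ_i :  (λ_i - j - 1) + (λ'_j - i - 1) + 1
hook : List ℕ → ℕ → ℕ → ℕ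
hook la i j = (nth la i ∸ suc j) ℕ.+ (conjPart la j ∸ suc i) ℕ.+ 1

IsCore : ℕ → List ℕ → Set
IsCore n la = ∀ i j → i ℕ.< length la → j ℕ.< nth la i → ¬ (n ∣ hook la i j)

-- x ∈ B, for x ≥ 0 (negative integers are in B automatically):
-- x is a first-column hook length h_{k1}
InB : List ℕ → ℕ → Set
InB la x = Σ ℕ λ k → k ℕ.< length la × hook la k 0 ≡ x

-- b : ℕ → ℕ are the level numbers of λ: for 0 ≤ i ≤ n-1, b i is the
-- least integer q with q n + i ∉ B.  (Negative q always give
-- q n + i < 0, which lies in B, so the least such q is ≥ 0.)
LevelNumbers : ℕ → List ℕ → (ℕ → ℕ) → Set
LevelNumbers n la b =
  ∀ i → i ℕ.< n →
    ¬ InB la (b i ℕ.* n ℕ.+ i) × (∀ q → q ℕ.< b i → InB la (q ℕ.* n ℕ.+ i))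

open Data.List.Sort ≤-decTotalOrder using (sort)

pList : ℕ → (ℕ → ℕ) → List ℕ
pList n b = sort (map (λ i → b i ℕ.* n ℕ.+ i) (upTo n))

-- p_i, 1-based
p : ℕ → (ℕ → ℕ) → ℕ → ℕ
p n b i = nth (pList n b) (i ∸ 1)

Ψcoord : ℕ → (ℕ → ℕ) → ℕ → ℕ → ℤ
Ψcoord n b i j = + floorDiv (p n b (suc j) ∸ p n b i) n

-- Geometry.  Points of V are given by rational coordinates
-- x : ℕ → ℚ (only x 1, …, x n matter).  Roots α_ij = e_i - e_{j+1}
-- are indexed by pairs 1 ≤ i ≤ j ≤ n-1.

Point : Set
Point = ℕ → ℚ

InV : ℕ → Point → Set
InV n x = sumℚ (map x (range 1 n)) ≡ ℚ.0ℚ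

ip : Point → ℕ → ℕ → ℚ
ip x i j = x i ℚ.- x (suc j)

IsRoot : ℕ → ℕ → ℕ → Set
IsRoot n i j = 1 ℕ.≤ i × i ℕ.≤ j × j ℕ.< n

IsShiHyp : ℕ → ℕ → ℕ → ℕ → ℤ → Set
IsShiHyp n m i j k = IsRoot n i j × ℤ.- (+ m) ℤ.< k × k ℤ.≤ + m

-- A region of the m-Shi arrangement is described by a sign vector
-- σ i j k = true  meaning  ⟨x,α_ij⟩ > k  on the region,
-- σ i j k = false meaning  ⟨x,α_ij⟩ < k  on the region.
SignVec : Set
SignVec = ℕ → ℕ → ℤ → Bool

OnSide : Bool → ℚ → ℤ → Set
OnSide true  v k = ℤ→ℚ k ℚ.< v
OnSide false v k = v ℚ.< ℤ→ℚ k

InRegion : ℕ → ℕ → SignVec → Point → Set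
InRegion n m σ x =
  InV n x × (∀ i j k → IsShiHyp n m i j k → OnSide (σ i j k) (ip x i j) k)

-- σ describes a region: the cell is nonempty (cells of a hyperplane
-- arrangement are convex, hence the nonempty ones are exactly the regions)
IsRegion : ℕ → ℕ → SignVec → Set
IsRegion n m σ = ∃ λ x → InRegion n m σ x

IsDominant : ℕ → ℕ → SignVec → Set
IsDominant n m σ =
  ∀ x → InRegion n m σ x → ∀ i → 1 ℕ.≤ i → i ℕ.< n → ℚ.0ℚ ℚ.≤ ip x i i

InAlcove : ℕ → (ℕ → ℕ → ℤ) → Point → Set
InAlcove n K x =
  InV n x × (∀ i j → IsRoot n i j →
               ℤ→ℚ (K i j) ℚ.< ip x i j × ip x i j ℚ.< ℤ→ℚ (K i j ℤ.+ + 1))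

IsAlcove : ℕ → (ℕ → ℕ → ℤ) → Set
IsAlcove n K = ∃ λ x → InAlcove n K x

AlcoveInRegion : ℕ → ℕ → (ℕ → ℕ → ℤ) → SignVec → Set
AlcoveInRegion n m K σ = ∀ x → InAlcove n K x → InRegion n m σ x

-- Number of hyperplanes H_{α,k} (k ∈ ℤ) separating the alcove with Shi
-- coordinates K from A₀ (whose Shi coordinates are all 0): for each root
-- α these are H_{α,1},…,H_{α,K_α} if K_α ≥ 0 and H_{α,K_α+1},…,H_{α,0}
-- if K_α < 0, i.e. |K_α| of them.
sepCount : ℕ → (ℕ → ℕ → ℤ) → ℕ
sepCount n K =
  sumℕ (map (λ i → sumℕ (map (λ j → ∣ K i j ∣) (range i (n ∸ 1))))
            (range 1 (n ∸ 1)))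

IsMinimalAlcove : ℕ → ℕ → SignVec → (ℕ → ℕ → ℤ) → Set
IsMinimalAlcove n m σ K =
  IsAlcove n K × AlcoveInRegion n m K σ ×
  (∀ K' → IsAlcove n K' → AlcoveInRegion n m K' σ → sepCount n K ℕ.≤ sepCount n K')

-- H_{α_{i0 j0},k0} is a wall of the region σ: it supports a facet, i.e.
-- some point y ∈ V on H lies strictly on the σ-side of every other
-- hyperplane of the arrangement (such y lies in the relative interior
-- of a facet of the closure of the region).
IsWall : ℕ → ℕ → SignVec → ℕ → ℕ → ℤ → Set
IsWall n m σ i0 j0 k0 =
  IsShiHyp n m i0 j0 k0 ×
  ∃ λ y → InV n y × ip y i0 j0 ≡ ℤ→ℚ k0 ×
    (∀ i j k → IsShiHyp n m i j k → ¬ (i ≡ i0 × j ≡ j0 × k ≡ k0) →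
       OnSide (σ i j k) (ip y i j) k)

InA0 : ℕ → Point → Set
InA0 n x = InV n x × ip x 1 (n ∸ 1) ℚ.< ℚ.1ℚ ×
           (∀ i → 1 ℕ.≤ i → i ℕ.< n → ℚ.0ℚ ℚ.< ip x i i)

Separates : ℕ → ℕ → SignVec → ℕ → ℕ → ℤ → Set
Separates n m σ i j k =
  ((∀ x → InRegion n m σ x → ℤ→ℚ k ℚ.≤ ip x i j) × (∀ x → InA0 n x → ip x i j ℚ.≤ ℤ→ℚ k))
  ⊎' ((∀ x → InRegion n m σ x → ip x i j ℚ.≤ ℤ→ℚ k) × (∀ x → InA0 n x → ℤ→ℚ k ℚ.≤ ip x i j))
  where open import Data.Sum renaming (_⊎_ to _⊎'_)

IsSeparatingWall : ℕ → ℕ → SignVec → ℕ → ℕ → ℤ → Set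
IsSeparatingWall n m σ i j k = IsWall n m σ i j k × Separates n m σ i j k

-- For 1 ≤ k ≤ m, A₀ lies in {⟨x,α⟩ < 1 ≤ k}, so H_{α,k} separates the
-- region σ from A₀ exactly when σ places the region on the side
-- ⟨x,α⟩ > k, i.e. σ i j k = true.  r and c count these.
indicator : Bool → ℕ
indicator true  = 1
indicator false = 0

rStat : ℕ → ℕ → SignVec → ℕ
rStat n m σ =
  sumℕ (map (λ j → sumℕ (map (λ k → indicator (σ 1 j (+ k))) (range 1 m)))
            (range 1 (n ∸ 1)))

cStat : ℕ → ℕ → SignVec → ℕ
cStat n m σ =
  sumℕ (map (λ i → sumℕ (map (λ k → indicator (σ i (n ∸ 1) (+ k))) (range 1 m)))
            (range 1 (n ∸ 1)))

{-# OPTIONS --safe #-}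
-- Let P₀ ≤ … ≤ P_{n−1} be the sorted bead positions b_i n + i, so that the Shi coordinates of Ψ(λ) are
-- K_ij = ⌊(P_j − P_{i−1})/n⌋, and P₀ = 0 because b₀ = 0.  Since Ψ(λ) lies in R, for 1 ≤ k ≤ m the
-- hyperplane H_{α,k} separates R from A₀ exactly when k ≤ K_α; so once all K_α ≤ m, r(R) and c(R) are the
-- sums of the first-row and last-column coordinates.  The separating wall H_{θ,m} forces K_θ = m: A₀ lies
-- below it, while a point y of the wall satisfies ⟨y,α_{1j}⟩ + ⟨y,α_{j+1,θ}⟩ = m, whence K_{1j} + K_{j+1,θ} < m
-- and, by subadditivity of ⌊·/n⌋, K_θ ≤ m (for n = 2 minimality of the alcove is used instead).  The top
-- position P_{n−1} = mn + 1 is then the bead of runner 1, with b₁ = m and all other b_i < m.  Now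
-- r(R) = Σ P_j/n = Σ b_i, which is ℓ(λ) because the first-column hooks of an n-core fill exactly the first b_i
-- places of each runner; c(R) = Σ (P_{n−1} − P_j)/n; and the largest first-column hook (m − 1)n + 1 gives λ₁.
module Submission where

open import Defs

module ShiCoreStatistics where

  open import Data.Nat as ℕ
    using (ℕ; zero; suc; _+_; z<s; _*_; _∸_; _≤_; _<_; _>_; z≤n; s≤s; _≟_; _<?_; _≤?_; _⊓_; NonZero)
  open import Data.Nat.Properties
  open import Data.Nat.DivMod
    using (_/_; _%_; m≡m%n+[m/n]*n; [m+kn]%n≡m%n; m<n⇒m%n≡m; m%n<n; /-monoˡ-≤; m<n*o⇒m/o<n;
           +-distrib-/-∣ˡ; m*n/n≡m; m<n⇒m/n≡0)
  open import Data.Nat.Divisibility using (_∣_; ∣-refl; n∣m*n)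
  open import Data.Nat.Tactic.RingSolver using (solve-∀)
  open import Data.Integer as ℤ using (ℤ; +_; +≤+; +<+)
  import Data.Integer.Properties as ℤP
  open import Data.Rational as ℚ using (ℚ)
  import Data.Rational.Properties as ℚP
  open import Data.Rational.Unnormalised as ℚᵘ using (mkℚᵘ)
  import Data.Rational.Unnormalised.Properties as ℚᵘP
  open import Data.Rational.Solver using (module +-*-Solver)
  open import Data.List using (List; []; _∷_; length; filter; map; upTo; applyUpTo)
  import Data.List.Properties as List
  open import Data.List.Membership.Propositional using (_∈_)
  open import Data.List.Membership.DecPropositional _≟_ using (_∈?_)
  open import Data.List.Membership.Propositional.Properties
    using (∈-map⁺; ∈-map⁻; ∈-filter⁺; ∈-filter⁻; ∈-applyUpTo⁺; ∈-applyUpTo⁻)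
  open import Data.List.Relation.Unary.Any using (here; there)
  open import Data.List.Relation.Unary.All as All using (All; []; _∷_)
  import Data.List.Relation.Unary.All.Properties as All
  open import Data.List.Relation.Unary.AllPairs using (AllPairs; []; _∷_)
  import Data.List.Relation.Unary.AllPairs.Properties as AllPairs
  open import Data.List.Relation.Unary.Linked using (Linked; []; [-]; _∷_)
  open import Data.List.Relation.Binary.Permutation.Propositional using (_↭_; ↭-sym)
  import Data.List.Relation.Binary.Permutation.Propositional.Properties as Perm
  open import Data.Nat.ListAction.Properties using (sum-↭)
  open import Data.List.Sort ≤-decTotalOrder using (sort-↭; sort-↗)
  open import Data.Bool using (true; false)
  open import Data.Product using (∃; _×_; _,_; proj₁; proj₂)
  open import Data.Sum using (inj₁; inj₂)
  open import Data.Empty using (⊥-elim)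
  open import Relation.Nullary using (¬_; Dec; yes; no; does)
  open import Relation.Nullary.Decidable using (_×-dec_; dec-true; dec-false; map′)
  open import Relation.Binary.PropositionalEquality

  ℤ→ℚ-toℚᵘ : ∀ k → ℚ.toℚᵘ (ℤ→ℚ k) ℚᵘ.≃ mkℚᵘ k 0
  ℤ→ℚ-toℚᵘ k = ℚP.toℚᵘ-fromℚᵘ (mkℚᵘ k 0)

  ℤ→ℚ-cancel-< : ∀ {a b} → ℤ→ℚ a ℚ.< ℤ→ℚ b → a ℤ.< b
  ℤ→ℚ-cancel-< {a} {b} a<b = subst₂ ℤ._<_ (ℤP.*-identityʳ a) (ℤP.*-identityʳ b)
    (ℚᵘP.drop-*<* (ℚᵘP.<-respʳ-≃ (ℤ→ℚ-toℚᵘ b)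
      (ℚᵘP.<-respˡ-≃ (ℤ→ℚ-toℚᵘ a) (ℚP.toℚᵘ-mono-< a<b))))

  ℤ→ℚ-mono-≤ : ∀ {a b} → a ℤ.≤ b → ℤ→ℚ a ℚ.≤ ℤ→ℚ b
  ℤ→ℚ-mono-≤ {a} {b} a≤b = ℚP.toℚᵘ-cancel-≤
    (ℚᵘP.≤-respʳ-≃ (ℚᵘP.≃-sym (ℤ→ℚ-toℚᵘ b)) (ℚᵘP.≤-respˡ-≃ (ℚᵘP.≃-sym (ℤ→ℚ-toℚᵘ a))
      (ℚᵘ.*≤* (subst₂ ℤ._≤_ (sym (ℤP.*-identityʳ a)) (sym (ℤP.*-identityʳ b)) a≤b))))

  ℤ→ℚ-homo-+ : ∀ a b → ℤ→ℚ (a ℤ.+ b) ≡ ℤ→ℚ a ℚ.+ ℤ→ℚ b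
  ℤ→ℚ-homo-+ a b = ℚP.toℚᵘ-injective (ℚᵘP.≃-trans (ℤ→ℚ-toℚᵘ (a ℤ.+ b))
    (ℚᵘP.≃-trans sum-of-integers (ℚᵘP.≃-sym (ℚᵘP.≃-trans (ℚP.toℚᵘ-homo-+ (ℤ→ℚ a) (ℤ→ℚ b))
      (ℚᵘP.+-cong (ℤ→ℚ-toℚᵘ a) (ℤ→ℚ-toℚᵘ b))))))
    where
    sum-of-integers : mkℚᵘ (a ℤ.+ b) 0 ℚᵘ.≃ mkℚᵘ a 0 ℚᵘ.+ mkℚᵘ b 0
    sum-of-integers = ℚᵘ.*≡* (cong₂ (λ x y → (x ℤ.+ y) ℤ.* + 1) (sym (ℤP.*-identityʳ a)) (sym (ℤP.*-identityʳ b)))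

  ℤ→ℚ-cancel-<ₙ : ∀ {a b} → ℤ→ℚ (+ a) ℚ.< ℤ→ℚ (+ b) → a < b
  ℤ→ℚ-cancel-<ₙ lt = ℤP.drop‿+<+ (ℤ→ℚ-cancel-< lt)

  nth-All : ∀ {P : ℕ → Set} xs {t} → All P xs → t < length xs → P (nth xs t)
  nth-All (x ∷ xs) {zero}  (px ∷ _)   _         = px
  nth-All (x ∷ xs) {suc t} (_  ∷ pxs) (s≤s t<ℓ) = nth-All xs pxs t<ℓ

  nth-∈ : ∀ xs {t} → t < length xs → nth xs t ∈ xs
  nth-∈ (x ∷ xs) {zero}  _         = here refl
  nth-∈ (x ∷ xs) {suc t} (s≤s t<ℓ) = there (nth-∈ xs t<ℓ)

  ∈⇒nth : ∀ xs {x} → x ∈ xs → ∃ λ t → t < length xs × nth xs t ≡ x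
  ∈⇒nth (y ∷ xs) (here refl) = 0 , s≤s z≤n , refl
  ∈⇒nth (y ∷ xs) (there x∈xs) with ∈⇒nth xs x∈xs
  ... | t , t<ℓ , eq = suc t , s≤s t<ℓ , eq

  Decreasing⇒nth-antitone : ∀ {xs} → Decreasing xs → ∀ {t t'} → t ≤ t' → t' < length xs →
                            nth xs t' ≤ nth xs t
  Decreasing⇒nth-antitone dec[x]          {zero}  {zero}   _         _         = ≤-refl
  Decreasing⇒nth-antitone dec[x]          {_}     {suc _}  _         (s≤s ())
  Decreasing⇒nth-antitone (dec∷ y≤x dec)  {zero}  {zero}   _         _         = ≤-refl
  Decreasing⇒nth-antitone (dec∷ y≤x dec)  {zero}  {suc t'} _         (s≤s t'<ℓ) =
    ≤-trans (Decreasing⇒nth-antitone dec z≤n t'<ℓ) y≤x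
  Decreasing⇒nth-antitone (dec∷ y≤x dec)  {suc t} {suc t'} (s≤s t≤t') (s≤s t'<ℓ) =
    Decreasing⇒nth-antitone dec t≤t' t'<ℓ

  Linked⇒nth-monotone : ∀ {xs} → Linked _≤_ xs → ∀ {t t'} → t ≤ t' → t' < length xs →
                        nth xs t ≤ nth xs t'
  Linked⇒nth-monotone [-]           {zero}  {zero}   _          _          = ≤-refl
  Linked⇒nth-monotone [-]           {_}     {suc _}  _          (s≤s ())
  Linked⇒nth-monotone (x≤y ∷ sorted) {zero}  {zero}   _          _          = ≤-refl
  Linked⇒nth-monotone (x≤y ∷ sorted) {zero}  {suc t'} _          (s≤s t'<ℓ) =
    ≤-trans x≤y (Linked⇒nth-monotone sorted z≤n t'<ℓ)
  Linked⇒nth-monotone (x≤y ∷ sorted) {suc t} {suc t'} (s≤s t≤t') (s≤s t'<ℓ) =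
    Linked⇒nth-monotone sorted t≤t' t'<ℓ

  length-filter-initial : ∀ {P : ℕ → Set} (P? : ∀ x → Dec (P x)) xs {s} → s ≤ length xs →
    (∀ t → t < length xs → (t < s → P (nth xs t)) × (P (nth xs t) → t < s)) →
    length (filter P? xs) ≡ s
  length-filter-initial P? [] z≤n _ = refl
  length-filter-initial P? (x ∷ xs) {s} s≤ℓ initial with P? x | s | s≤ℓ
  ... | yes px | zero  | _         = ⊥-elim (n≮0 (proj₂ (initial 0 (s≤s z≤n)) px))
  ... | yes px | suc s | s≤s s≤ℓ′ = cong suc (length-filter-initial P? xs s≤ℓ′ λ t t<ℓ →
        (λ t<s → proj₁ (initial (suc t) (s≤s t<ℓ)) (s≤s t<s)) ,
        (λ pt → ≤-pred (proj₂ (initial (suc t) (s≤s t<ℓ)) pt)))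
  ... | no ¬px | zero  | _         = length-filter-initial P? xs z≤n λ t t<ℓ →
        (λ ()) , (λ pt → ⊥-elim (n≮0 (proj₂ (initial (suc t) (s≤s t<ℓ)) pt)))
  ... | no ¬px | suc s | _         = ⊥-elim (¬px (proj₁ (initial 0 (s≤s z≤n)) (s≤s z≤n)))

  antitone-threshold : ∀ {Q : ℕ → Set} → (∀ t → Dec (Q t)) → (∀ {t t'} → t ≤ t' → Q t' → Q t) →
    ∀ N → ∃ λ s → s ≤ N × (∀ t → t < N → (t < s → Q t) × (Q t → t < s))
  antitone-threshold Q? antitone zero = 0 , z≤n , λ _ ()
  antitone-threshold {Q} Q? antitone (suc N) with antitone-threshold Q? antitone N | Q? N
  ... | _ , _ , _ | yes qN = suc N , ≤-refl , λ t t<1+N → (λ _ → antitone (≤-pred t<1+N) qN) , (λ _ → t<1+N)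
  ... | s , s≤N , below-N | no ¬qN = s , m≤n⇒m≤1+n s≤N , below-1+N
    where
    below-1+N : ∀ t → t < suc N → (t < s → Q t) × (Q t → t < s)
    below-1+N t t<1+N with m≤n⇒m<n∨m≡n (≤-pred t<1+N)
    ... | inj₁ t<N  = below-N t t<N
    ... | inj₂ refl = (λ t<s → ⊥-elim (<⇒≱ t<s s≤N)) , (λ qN → ⊥-elim (¬qN qN))

  sum-map-+ : ∀ (f g : ℕ → ℕ) xs → sumℕ (map (λ i → f i + g i) xs) ≡ sumℕ (map f xs) + sumℕ (map g xs)
  sum-map-+ f g [] = refl
  sum-map-+ f g (x ∷ xs) = trans (cong (λ s → f x + g x + s) (sum-map-+ f g xs)) (interchange (f x) (g x) _ _)
    where
    interchange : ∀ a b c d → a + b + (c + d) ≡ a + c + (b + d)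
    interchange = solve-∀

  sum-map-const : ∀ c (xs : List ℕ) → sumℕ (map (λ _ → c) xs) ≡ length xs * c
  sum-map-const c [] = refl
  sum-map-const c (x ∷ xs) = cong (λ s → c + s) (sum-map-const c xs)

  sumℤ-map-+≡+-sumℕ : ∀ (f : ℕ → ℕ) xs → sumℤ (map (λ i → + f i) xs) ≡ + sumℕ (map f xs)
  sumℤ-map-+≡+-sumℕ f [] = refl
  sumℤ-map-+≡+-sumℕ f (x ∷ xs) = cong (λ s → + f x ℤ.+ s) (sumℤ-map-+≡+-sumℕ f xs)

  sum-applyUpTo-indicator : ∀ (h : ℕ → ℕ) {N K} → K ≤ N →
    (∀ t → t < N → t < K → h t ≡ 1) → (∀ t → t < N → K ≤ t → h t ≡ 0) →
    sumℕ (applyUpTo h N) ≡ K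
  sum-applyUpTo-indicator h {zero} z≤n _ _ = refl
  sum-applyUpTo-indicator h {suc N} {zero} _ _ zero-from =
    cong₂ _+_ (zero-from 0 z<s z≤n)
      (sum-applyUpTo-indicator (λ t → h (suc t)) z≤n (λ _ _ ()) (λ t t<N _ → zero-from (suc t) (s≤s t<N) z≤n))
  sum-applyUpTo-indicator h {suc N} {suc K} (s≤s K≤N) one-below zero-from =
    cong₂ _+_ (one-below 0 z<s z<s)
      (sum-applyUpTo-indicator (λ t → h (suc t)) K≤N
        (λ t t<N t<K → one-below (suc t) (s≤s t<N) (s≤s t<K))
        (λ t t<N K≤t → zero-from (suc t) (s≤s t<N) (s≤s K≤t)))

  applyUpTo-nth : ∀ (g : ℕ → ℕ) xs → applyUpTo (λ t → g (nth xs t)) (length xs) ≡ map g xs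
  applyUpTo-nth g []       = refl
  applyUpTo-nth g (x ∷ xs) = cong (g x ∷_) (applyUpTo-nth g xs)

  sum-applyUpTo-suc : ∀ (h : ℕ → ℕ) N → sumℕ (applyUpTo h (suc N)) ≡ sumℕ (applyUpTo h N) + h N
  sum-applyUpTo-suc h zero    = +-comm (h 0) 0
  sum-applyUpTo-suc h (suc N) = trans (cong (λ s → h 0 + s) (sum-applyUpTo-suc (λ t → h (suc t)) N)) (sym (+-assoc (h 0) _ _))

  largestPart≡nth-0 : ∀ xs → 0 < length xs → largestPart xs ≡ nth xs 0
  largestPart≡nth-0 (x ∷ xs) _ = refl

  map-applyUpTo-cong : ∀ {A : Set} (f : ℕ → ℕ) N {g h : ℕ → A} → (∀ {t} → t < N → g (f t) ≡ h (f t)) →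
                       map g (applyUpTo f N) ≡ map h (applyUpTo f N)
  map-applyUpTo-cong f N g≗h = List.map-cong-local (All.applyUpTo⁺₁ f N g≗h)

  AllPairs-map-within : ∀ {P : ℕ → Set} {R S : ℕ → ℕ → Set} →
    (∀ {x y} → P x → P y → R x y → S x y) → ∀ {xs} → All P xs → AllPairs R xs → AllPairs S xs
  AllPairs-map-within f []         []         = []
  AllPairs-map-within f (px ∷ pxs) (rx ∷ rxs) =
    All.zipWith (λ (py , r) → f px py r) (pxs , rx) ∷ AllPairs-map-within f pxs rxs

  δ : ℕ → ℕ → ℕ
  δ a i = indicator (does (a ≟ i))

  δ-refl : ∀ {a i} → a ≡ i → δ a i ≡ 1
  δ-refl {a} {i} a≡i = cong indicator (dec-true (a ≟ i) a≡i)

  δ-≢ : ∀ {a i} → a ≢ i → δ a i ≡ 0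
  δ-≢ {a} {i} a≢i = cong indicator (dec-false (a ≟ i) a≢i)

  sum-δ-applyUpTo-∉ : ∀ (f : ℕ → ℕ) N {a} → (∀ t → t < N → a ≢ f t) →
                      sumℕ (map (δ a) (applyUpTo f N)) ≡ 0
  sum-δ-applyUpTo-∉ f zero    _    = refl
  sum-δ-applyUpTo-∉ f (suc N) a∉ =
    cong₂ _+_ (δ-≢ (a∉ 0 z<s)) (sum-δ-applyUpTo-∉ (λ t → f (suc t)) N (λ t t<N → a∉ (suc t) (s≤s t<N)))

  sum-δ-applyUpTo-∈ : ∀ (f : ℕ → ℕ) N {a} → (∀ {t t'} → f t ≡ f t' → t ≡ t') →
                      ∀ {t₀} → t₀ < N → a ≡ f t₀ → sumℕ (map (δ a) (applyUpTo f N)) ≡ 1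
  sum-δ-applyUpTo-∈ f (suc N) {a} f-injective {t₀} t₀<N a≡ft₀ with a ≟ f 0 | t₀ | t₀<N
  ... | yes a≡f0 | _      | _         = cong₂ _+_ (δ-refl a≡f0)
        (sum-δ-applyUpTo-∉ (λ t → f (suc t)) N λ t _ a≡ft → 0≢1+n (f-injective (trans (sym a≡f0) a≡ft)))
  ... | no a≢f0  | zero   | _         = ⊥-elim (a≢f0 a≡ft₀)
  ... | no a≢f0  | suc t₀ | s≤s t₀<N = cong₂ _+_ (δ-≢ a≢f0)
        (sum-δ-applyUpTo-∈ (λ t → f (suc t)) N (λ eq → suc-injective (f-injective eq)) t₀<N a≡ft₀)

  length-filter-≟-∷ : ∀ (κ : ℕ → ℕ) i x xs →
    length (filter (λ y → κ y ≟ i) (x ∷ xs)) ≡ δ (κ x) i + length (filter (λ y → κ y ≟ i) xs)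
  length-filter-≟-∷ κ i x xs with κ x ≟ i
  ... | yes κx≡i = trans (cong length (List.filter-accept (λ y → κ y ≟ i) κx≡i))
                         (cong (λ s → s + length (filter (λ y → κ y ≟ i) xs)) (sym (δ-refl κx≡i)))
  ... | no  κx≢i = trans (cong length (List.filter-reject (λ y → κ y ≟ i) κx≢i))
                         (cong (λ s → s + length (filter (λ y → κ y ≟ i) xs)) (sym (δ-≢ κx≢i)))

  length≡sum-length-filter-≟ : ∀ n (κ : ℕ → ℕ) → (∀ x → κ x < n) → ∀ xs →
    length xs ≡ sumℕ (map (λ i → length (filter (λ y → κ y ≟ i) xs)) (upTo n))
  length≡sum-length-filter-≟ n κ κ<n [] = sym (trans (sum-map-const 0 (upTo n)) (*-zeroʳ (length (upTo n))))
  length≡sum-length-filter-≟ n κ κ<n (x ∷ xs) = begin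
    suc (length xs)
      ≡⟨ cong suc (length≡sum-length-filter-≟ n κ κ<n xs) ⟩
    suc (count xs)
      ≡⟨ cong (λ s → s + count xs) (sym (sum-δ-applyUpTo-∈ (λ t → t) n (λ eq → eq) (κ<n x) refl)) ⟩
    sumℕ (map (δ (κ x)) (upTo n)) + count xs
      ≡⟨ sum-map-+ (δ (κ x)) (λ i → length (filter (λ y → κ y ≟ i) xs)) (upTo n) ⟨
    sumℕ (map (λ i → δ (κ x) i + length (filter (λ y → κ y ≟ i) xs)) (upTo n))
      ≡⟨ cong sumℕ (List.map-cong (λ i → length-filter-≟-∷ κ i x xs) (upTo n)) ⟨
    sumℕ (map (λ i → length (filter (λ y → κ y ≟ i) (x ∷ xs))) (upTo n)) ∎
    where
    open ≡-Reasoning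
    count : List ℕ → ℕ
    count ys = sumℕ (map (λ i → length (filter (λ y → κ y ≟ i) ys)) (upTo n))

  descending-enumeration⇒length≡ : ∀ b xs → AllPairs _>_ xs →
    (∀ {q} → q ∈ xs → q < b) → (∀ {q} → q < b → q ∈ xs) → length xs ≡ b
  descending-enumeration⇒length≡ zero    []       _ _ _ = refl
  descending-enumeration⇒length≡ zero    (x ∷ xs) _ bounded _ = ⊥-elim (n≮0 (bounded (here refl)))
  descending-enumeration⇒length≡ (suc b) []       _ _ complete with complete (n<1+n b)
  ... | ()
  descending-enumeration⇒length≡ (suc b) (x ∷ xs) (x>xs ∷ descending) bounded complete =
    cong suc (descending-enumeration⇒length≡ b xs descending bounded′ complete′)
    where
    x≡b : x ≡ b
    x≡b with complete (n<1+n b)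
    ... | here b≡x     = sym b≡x
    ... | there b∈xs   = ⊥-elim (<⇒≱ (All.lookup x>xs b∈xs) (≤-pred (bounded (here refl))))
    bounded′ : ∀ {q} → q ∈ xs → q < b
    bounded′ q∈xs = subst (_ <_) x≡b (All.lookup x>xs q∈xs)
    complete′ : ∀ {q} → q < b → q ∈ xs
    complete′ q<b with complete (m<n⇒m<1+n q<b)
    ... | here q≡x     = ⊥-elim (<-irrefl (trans q≡x x≡b) q<b)
    ... | there q∈xs   = q∈xs

  module _ (n : ℕ) .{{_ : NonZero n}} where

    [q*n+i]%n≡i : ∀ q {i} → i < n → (q * n + i) % n ≡ i
    [q*n+i]%n≡i q {i} i<n = trans (cong (_% n) (+-comm (q * n) i)) (trans ([m+kn]%n≡m%n i q n) (m<n⇒m%n≡m i<n))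

    [q*n+i]/n≡q : ∀ q {i} → i < n → (q * n + i) / n ≡ q
    [q*n+i]/n≡q q {i} i<n = begin
      (q * n + i) / n   ≡⟨ +-distrib-/-∣ˡ i (n∣m*n q) ⟩
      q * n / n + i / n ≡⟨ cong₂ _+_ (m*n/n≡m q n) (m<n⇒m/n≡0 i<n) ⟩
      q + 0             ≡⟨ +-identityʳ q ⟩
      q                 ∎
      where open ≡-Reasoning

    m≡m/n*n+m%n : ∀ m → m ≡ m / n * n + m % n
    m≡m/n*n+m%n m = trans (m≡m%n+[m/n]*n m n) (+-comm (m % n) _)

    m<[m/n+1]*n : ∀ m → m < suc (m / n) * n
    m<[m/n+1]*n m = begin-strict
      m                 ≡⟨ m≡m/n*n+m%n m ⟩
      m / n * n + m % n <⟨ +-monoʳ-< (m / n * n) (m%n<n m n) ⟩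
      m / n * n + n     ≡⟨ +-comm (m / n * n) n ⟩
      suc (m / n) * n   ∎
      where open ≤-Reasoning

    /-subadditive : ∀ u v → (u + v) / n ≤ suc (u / n + v / n)
    /-subadditive u v = ≤-pred (m<n*o⇒m/o<n (begin-strict
      u + v                               <⟨ +-mono-< (m<[m/n+1]*n u) (m<[m/n+1]*n v) ⟩
      suc (u / n) * n + suc (v / n) * n   ≡⟨ distrib (u / n) (v / n) n ⟩
      suc (suc (u / n + v / n)) * n       ∎))
      where
      open ≤-Reasoning
      distrib : ∀ a b n → suc a * n + suc b * n ≡ suc (suc (a + b)) * n
      distrib = solve-∀

    /-mono-<-on-residue-class : ∀ {x y} → x % n ≡ y % n → y < x → y / n < x / n
    /-mono-<-on-residue-class {x} {y} x≡y y<x with x / n ≤? y / n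
    ... | no x/n≰y/n = ≰⇒> x/n≰y/n
    ... | yes x/n≤y/n = ⊥-elim (<⇒≱ y<x (begin
      x                 ≡⟨ m≡m/n*n+m%n x ⟩
      x / n * n + x % n ≤⟨ +-mono-≤ (*-monoˡ-≤ n x/n≤y/n) (≤-reflexive x≡y) ⟩
      y / n * n + y % n ≡⟨ m≡m/n*n+m%n y ⟨
      y                 ∎))
      where open ≤-Reasoning

    /-of-difference : ∀ c d j {r} → r < n → ((c + d) * n + (j + r) ∸ (c * n + j)) / n ≡ d
    /-of-difference c d j {r} r<n = begin
      ((c + d) * n + (j + r) ∸ (c * n + j)) / n   ≡⟨ cong (λ x → (x ∸ (c * n + j)) / n) (regroup c d j r n) ⟩
      (c * n + j + (d * n + r) ∸ (c * n + j)) / n ≡⟨ cong (_/ n) (m+n∸m≡n (c * n + j) (d * n + r)) ⟩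
      (d * n + r) / n                             ≡⟨ [q*n+i]/n≡q d r<n ⟩
      d                                           ∎
      where
      open ≡-Reasoning
      regroup : ∀ c d j r n → (c + d) * n + (j + r) ≡ c * n + j + (d * n + r)
      regroup = solve-∀

    [a*n+i∸[c*n+j]]/n≡a∸c : ∀ {a c i j} → c ≤ a → j ≤ i → i < n → (a * n + i ∸ (c * n + j)) / n ≡ a ∸ c
    [a*n+i∸[c*n+j]]/n≡a∸c {a} {c} {i} {j} c≤a j≤i i<n =
      trans (cong (λ x → (x ∸ (c * n + j)) / n) (sym (cong₂ (λ u v → u * n + v) (m+[n∸m]≡n c≤a) (m+[n∸m]≡n j≤i))))
            (/-of-difference c (a ∸ c) j (≤-<-trans (m∸n≤m i j) i<n))

    [a*n+i∸[c*n+j]]/n≡a∸suc-c : ∀ {a c i j} → c < a → i < j → j < n →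
                                (a * n + i ∸ (c * n + j)) / n ≡ a ∸ suc c
    [a*n+i∸[c*n+j]]/n≡a∸suc-c {a} {c} {i} {j} c<a i<j j<n =
      trans (cong (λ x → (x ∸ (c * n + j)) / n) borrow) (/-of-difference c (a ∸ suc c) j remainder<n)
      where
      open ≡-Reasoning
      j≤n+i : j ≤ n + i
      j≤n+i = ≤-trans (<⇒≤ j<n) (m≤m+n n i)
      remainder<n : n + i ∸ j < n
      remainder<n = +-cancelʳ-< j (n + i ∸ j) n (subst (_< n + j) (sym (m∸n+n≡m j≤n+i)) (+-monoʳ-< n i<j))
      regroup : ∀ c d i n → (suc c + d) * n + i ≡ (c + d) * n + (n + i)
      regroup = solve-∀
      borrow : a * n + i ≡ (c + (a ∸ suc c)) * n + (j + (n + i ∸ j))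
      borrow = begin
        a * n + i                                 ≡⟨ cong (λ u → u * n + i) (m+[n∸m]≡n c<a) ⟨
        (suc c + (a ∸ suc c)) * n + i             ≡⟨ regroup c (a ∸ suc c) i n ⟩
        (c + (a ∸ suc c)) * n + (n + i)           ≡⟨ cong (λ u → (c + (a ∸ suc c)) * n + u) (m+[n∸m]≡n j≤n+i) ⟨
        (c + (a ∸ suc c)) * n + (j + (n + i ∸ j)) ∎

    length≡sum-of-runner-sizes : ∀ (b : ℕ → ℕ) xs → AllPairs _>_ xs →
      (∀ {x} → x ∈ xs → x / n < b (x % n)) → (∀ {q i} → i < n → q < b i → q * n + i ∈ xs) →
      length xs ≡ sumℕ (map b (upTo n))
    length≡sum-of-runner-sizes b xs descending bounded complete = begin
      length xs                                   ≡⟨ length≡sum-length-filter-≟ n (_% n) (λ x → m%n<n x n) xs ⟩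
      sumℕ (map (λ i → length (runner i)) (upTo n)) ≡⟨ cong sumℕ (map-applyUpTo-cong (λ t → t) n runner-size) ⟩
      sumℕ (map b (upTo n))                       ∎
      where
      open ≡-Reasoning
      runner : ℕ → List ℕ
      runner i = filter (λ x → x % n ≟ i) xs
      runner-size : ∀ {i} → i < n → length (runner i) ≡ b i
      runner-size {i} i<n = trans (sym (List.length-map (_/ n) (runner i)))
        (descending-enumeration⇒length≡ (b i) (map (_/ n) (runner i)) quotients-descending
           quotients-bounded quotients-complete)
        where
        quotients-descending : AllPairs _>_ (map (_/ n) (runner i))
        quotients-descending = AllPairs.map⁺ (AllPairs-map-within
          (λ x%n≡i y%n≡i x>y → /-mono-<-on-residue-class (trans x%n≡i (sym y%n≡i)) x>y)
          (All.all-filter (λ x → x % n ≟ i) xs) (AllPairs.filter⁺ (λ x → x % n ≟ i) descending))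
        quotients-bounded : ∀ {q} → q ∈ map (_/ n) (runner i) → q < b i
        quotients-bounded q∈ with ∈-map⁻ (_/ n) q∈
        ... | x , x∈ , refl with ∈-filter⁻ (λ x → x % n ≟ i) x∈
        ... | x∈xs , refl = bounded x∈xs
        quotients-complete : ∀ {q} → q < b i → q ∈ map (_/ n) (runner i)
        quotients-complete {q} q<b = subst (_∈ map (_/ n) (runner i)) ([q*n+i]/n≡q q i<n)
          (∈-map⁺ (_/ n) (∈-filter⁺ (λ x → x % n ≟ i) (complete i<n q<b) ([q*n+i]%n≡i q i<n)))

  hook+suc[t+j]≡arm+leg : ∀ la {t j} → j < nth la t → t < conjPart la j →
                          hook la t j + suc (t + j) ≡ nth la t + conjPart la j
  hook+suc[t+j]≡arm+leg la {t} {j} j<λt t<λ'j = begin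
    (nth la t ∸ suc j) + (conjPart la j ∸ suc t) + 1 + suc (t + j)
      ≡⟨ regroup (nth la t ∸ suc j) (conjPart la j ∸ suc t) t j ⟩
    (nth la t ∸ suc j + suc j) + (conjPart la j ∸ suc t + suc t)
      ≡⟨ cong₂ _+_ (m∸n+n≡m j<λt) (m∸n+n≡m t<λ'j) ⟩
    nth la t + conjPart la j ∎
    where
    open ≡-Reasoning
    regroup : ∀ a c t j → a + c + 1 + suc (t + j) ≡ (a + suc j) + (c + suc t)
    regroup = solve-∀

  module FirstColumnHooks (la : List ℕ) (partition : IsPartition la) where

    ℓ : ℕ
    ℓ = length la

    H : ℕ → ℕ
    H t = hook la t 0

    hooks : List ℕ
    hooks = applyUpTo H ℓ

    parts-positive : ∀ {t} → t < ℓ → 1 ≤ nth la t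
    parts-positive = nth-All la (proj₂ partition)

    conjPart-zero : conjPart la 0 ≡ ℓ
    conjPart-zero = length-filter-initial (0 <?_) la ≤-refl λ t t<ℓ → (λ _ → parts-positive t<ℓ) , (λ _ → t<ℓ)

    H+suc≡part+ℓ : ∀ {t} → t < ℓ → H t + suc t ≡ nth la t + ℓ
    H+suc≡part+ℓ {t} t<ℓ = begin
      H t + suc t              ≡⟨ cong (λ u → H t + suc u) (+-identityʳ t) ⟨
      H t + suc (t + 0)        ≡⟨ hook+suc[t+j]≡arm+leg la (parts-positive t<ℓ) (subst (t <_) (sym conjPart-zero) t<ℓ) ⟩
      nth la t + conjPart la 0 ≡⟨ cong (λ c → nth la t + c) conjPart-zero ⟩
      nth la t + ℓ             ∎
      where open ≡-Reasoning

    H-positive : ∀ t → 1 ≤ H t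
    H-positive t = m≤n+m 1 _

    H+t-antitone : ∀ {t t'} → t ≤ t' → t' < ℓ → H t' + t' ≤ H t + t
    H+t-antitone {t} {t'} t≤t' t'<ℓ = ≤-pred (begin
      suc (H t' + t') ≡⟨ +-suc (H t') t' ⟨
      H t' + suc t'   ≡⟨ H+suc≡part+ℓ t'<ℓ ⟩
      nth la t' + ℓ   ≤⟨ +-monoˡ-≤ ℓ (Decreasing⇒nth-antitone (proj₁ partition) t≤t' t'<ℓ) ⟩
      nth la t + ℓ    ≡⟨ H+suc≡part+ℓ (≤-<-trans t≤t' t'<ℓ) ⟨
      H t + suc t     ≡⟨ +-suc (H t) t ⟩
      suc (H t + t)   ∎)
      where open ≤-Reasoning

    H-antitone : ∀ {t t'} → t ≤ t' → t' < ℓ → H t' ≤ H t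
    H-antitone {t} {t'} t≤t' t'<ℓ =
      +-cancelʳ-≤ t _ _ (≤-trans (+-monoʳ-≤ (H t') t≤t') (H+t-antitone t≤t' t'<ℓ))

    hooks-descending : AllPairs _>_ hooks
    hooks-descending = AllPairs.applyUpTo⁺₁ H ℓ λ {t} {t'} t<t' t'<ℓ →
      +-cancelʳ-< t (H t') (H t) (<-≤-trans (+-monoʳ-< (H t') t<t') (H+t-antitone (<⇒≤ t<t') t'<ℓ))

    ∈hooks⇒InB : ∀ {x} → x ∈ hooks → InB la x
    ∈hooks⇒InB x∈ with ∈-applyUpTo⁻ H x∈
    ... | t , t<ℓ , x≡Ht = t , t<ℓ , sym x≡Ht

    InB⇒∈hooks : ∀ {x} → InB la x → x ∈ hooks
    InB⇒∈hooks (t , t<ℓ , refl) = ∈-applyUpTo⁺ H t<ℓ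

    InB? : ∀ x → Dec (InB la x)
    InB? x = map′ ∈hooks⇒InB InB⇒∈hooks (x ∈? hooks)

    0∉B : ¬ InB la 0
    0∉B (t , _ , Ht≡0) = n≮0 (subst (0 <_) Ht≡0 (H-positive t))

    y+S≤H+t : ∀ {y S t} → S ≤ ℓ → (∀ {u} → u < S → y < H u) → t < S → y + S ≤ H t + t
    y+S≤H+t {y} {suc S} {t} S<ℓ y<H (s≤s t≤S) = begin
      y + suc S  ≡⟨ +-suc y S ⟩
      suc y + S  ≤⟨ +-monoˡ-≤ S (y<H ≤-refl) ⟩
      H S + S    ≤⟨ H+t-antitone t≤S S<ℓ ⟩
      H t + t    ∎
      where open ≤-Reasoning

    -- Core closure: if x = H k is a first-column hook but y = x ∸ n is not, and s of the hooks exceed y,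
    -- then the cell (k, y + s ∸ ℓ) lies in λ and has hook length H k ∸ y = n.
    module Gap {y s : ℕ} (y∉B : ¬ InB la y) (s≤ℓ : s ≤ ℓ)
               (above-y : ∀ {t} → t < ℓ → (t < s → y < H t) × (y < H t → t < s)) where

      y<H : ∀ {t} → t < s → y < H t
      y<H t<s = proj₁ (above-y (<-≤-trans t<s s≤ℓ)) t<s

      H<y : ∀ {t} → t < ℓ → s ≤ t → H t < y
      H<y t<ℓ s≤t = ≤∧≢⇒< (≮⇒≥ λ y<Ht → <⇒≱ (proj₂ (above-y t<ℓ) y<Ht) s≤t)
                          λ Ht≡y → y∉B (_ , t<ℓ , Ht≡y)

      H+t<y+s : ∀ {t} → t < ℓ → s ≤ t → H t + t < y + s
      H+t<y+s t<ℓ s≤t = ≤-<-trans (H+t-antitone s≤t t<ℓ) (+-monoˡ-< s (H<y (≤-<-trans s≤t t<ℓ) ≤-refl))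

      ℓ≤y+s : ℓ ≤ y + s
      ℓ≤y+s with m≤n⇒m<n∨m≡n s≤ℓ
      ... | inj₁ s<ℓ = below ℓ ≤-refl s<ℓ
        where
        below : ∀ L → L ≤ ℓ → s < L → L ≤ y + s
        below (suc L) L<ℓ (s≤s s≤L) = <⇒≤ (<-≤-trans (s≤s (+-monoˡ-≤ L (H-positive L))) (H+t<y+s L<ℓ s≤L))
      ... | inj₂ s≡ℓ = subst (_≤ y + s) s≡ℓ (m≤n+m s y)

      column : ℕ
      column = y + s ∸ ℓ

      column+ℓ≡y+s : column + ℓ ≡ y + s
      column+ℓ≡y+s = m∸n+n≡m ℓ≤y+s

      column<part : ∀ {t} → t < s → column < nth la t
      column<part {t} t<s = +-cancelʳ-< ℓ column (nth la t) (begin-strict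
        column + ℓ    ≡⟨ column+ℓ≡y+s ⟩
        y + s         ≤⟨ y+S≤H+t s≤ℓ y<H t<s ⟩
        H t + t       <⟨ +-monoʳ-< (H t) (n<1+n t) ⟩
        H t + suc t   ≡⟨ H+suc≡part+ℓ (<-≤-trans t<s s≤ℓ) ⟩
        nth la t + ℓ  ∎)
        where open ≤-Reasoning

      column<part⇒<s : ∀ {t} → t < ℓ → column < nth la t → t < s
      column<part⇒<s {t} t<ℓ column<λt = ≰⇒> λ s≤t → <-irrefl refl (begin-strict
        column + ℓ     <⟨ +-monoˡ-< ℓ column<λt ⟩
        nth la t + ℓ   ≡⟨ H+suc≡part+ℓ t<ℓ ⟨
        H t + suc t    ≡⟨ +-suc (H t) t ⟩
        suc (H t + t)  ≤⟨ H+t<y+s t<ℓ s≤t ⟩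
        y + s          ≡⟨ column+ℓ≡y+s ⟨
        column + ℓ     ∎)
        where open ≤-Reasoning

      conjPart-column : conjPart la column ≡ s
      conjPart-column = length-filter-initial (column <?_) la s≤ℓ λ t t<ℓ → column<part , column<part⇒<s t<ℓ

      hook-column+y≡H : ∀ {t} → t < s → hook la t column + y ≡ H t
      hook-column+y≡H {t} t<s = +-cancelʳ-≡ (suc t + s) _ _ (begin
        hook la t column + y + (suc t + s)         ≡⟨ regroup₁ (hook la t column) y t s ⟩
        hook la t column + suc t + (y + s)         ≡⟨ cong (λ u → hook la t column + suc t + u) column+ℓ≡y+s ⟨
        hook la t column + suc t + (column + ℓ)    ≡⟨ regroup₂ (hook la t column) t column ℓ ⟩
        hook la t column + suc (t + column) + ℓ    ≡⟨ cong (_+ ℓ) (hook+suc[t+j]≡arm+leg la (column<part t<s) t<λ'j) ⟩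
        nth la t + conjPart la column + ℓ          ≡⟨ cong (λ c → nth la t + c + ℓ) conjPart-column ⟩
        nth la t + s + ℓ                           ≡⟨ regroup₃ (nth la t) s ℓ ⟩
        nth la t + ℓ + s                           ≡⟨ cong (_+ s) (H+suc≡part+ℓ (<-≤-trans t<s s≤ℓ)) ⟨
        H t + suc t + s                            ≡⟨ +-assoc (H t) (suc t) s ⟩
        H t + (suc t + s)                          ∎)
        where
        open ≡-Reasoning
        t<λ'j : t < conjPart la column
        t<λ'j = subst (t <_) (sym conjPart-column) t<s
        regroup₁ : ∀ h y t s → h + y + (suc t + s) ≡ h + suc t + (y + s)
        regroup₁ = solve-∀
        regroup₂ : ∀ h t j l → h + suc t + (j + l) ≡ h + suc (t + j) + l
        regroup₂ = solve-∀
        regroup₃ : ∀ a s l → a + s + l ≡ a + l + s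
        regroup₃ = solve-∀

    hooks-above : ∀ y → ∃ λ s → s ≤ ℓ × (∀ {t} → t < ℓ → (t < s → y < H t) × (y < H t → t < s))
    hooks-above y with antitone-threshold (λ t → (t <? ℓ) ×-dec (y <? H t))
                         (λ t≤t' (t'<ℓ , y<Ht') → ≤-<-trans t≤t' t'<ℓ , <-≤-trans y<Ht' (H-antitone t≤t' t'<ℓ)) ℓ
    ... | s , s≤ℓ , threshold = s , s≤ℓ , λ {t} t<ℓ →
          (λ t<s → proj₂ (proj₁ (threshold t t<ℓ) t<s)) , (λ y<Ht → proj₂ (threshold t t<ℓ) (t<ℓ , y<Ht))

    InB-∸ : ∀ {n} → IsCore n la → ∀ {x} → InB la x → n ≤ x → InB la (x ∸ n)
    InB-∸ {n} core {x} (k , k<ℓ , Hk≡x) n≤x with InB? (x ∸ n) | hooks-above (x ∸ n)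
    ... | yes x-n∈B | _                  = x-n∈B
    ... | no  x-n∉B | s , s≤ℓ , above-y =
          ⊥-elim (core k column k<ℓ (column<part k<s) (subst (n ∣_) (sym hook≡n) ∣-refl))
      where
      open Gap x-n∉B s≤ℓ above-y
      k<s : k < s
      k<s = proj₂ (above-y k<ℓ) (≤∧≢⇒< (subst (x ∸ n ≤_) (sym Hk≡x) (m∸n≤m x n))
                                      λ y≡Hk → x-n∉B (k , k<ℓ , sym y≡Hk))
      hook≡n : hook la k column ≡ n
      hook≡n = +-cancelʳ-≡ (x ∸ n) _ _ (begin
        hook la k column + (x ∸ n)   ≡⟨ hook-column+y≡H k<s ⟩
        H k                          ≡⟨ Hk≡x ⟩
        x                            ≡⟨ m+[n∸m]≡n n≤x ⟨
        n + (x ∸ n)                  ∎)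
        where open ≡-Reasoning

  module Abacus (n : ℕ) .{{_ : NonZero n}} (la : List ℕ) (partition : IsPartition la) (core : IsCore n la)
                (b : ℕ → ℕ) (levels : LevelNumbers n la b) where

    open FirstColumnHooks la partition public

    InB-descent : ∀ c d {i} → InB la ((c + d) * n + i) → InB la (c * n + i)
    InB-descent c zero    {i} bead = subst (λ q → InB la (q * n + i)) (+-identityʳ c) bead
    InB-descent c (suc d) {i} bead =
      InB-descent c d (subst (InB la) shifted (InB-∸ core bead (subst (n ≤_) (sym split) (m≤m+n n _))))
      where
      regroup : ∀ c d i n → (c + suc d) * n + i ≡ n + ((c + d) * n + i)
      regroup = solve-∀
      split : (c + suc d) * n + i ≡ n + ((c + d) * n + i)
      split = regroup c d i n
      shifted : (c + suc d) * n + i ∸ n ≡ (c + d) * n + i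
      shifted = trans (cong (_∸ n) split) (m+n∸m≡n n _)

    InB⇒<level : ∀ {q i} → i < n → InB la (q * n + i) → q < b i
    InB⇒<level {q} {i} i<n bead with b i ≤? q
    ... | no  bi≰q = ≰⇒> bi≰q
    ... | yes bi≤q with m≤n⇒∃[o]m+o≡n bi≤q
    ...   | d , bi+d≡q = ⊥-elim (proj₁ (levels i i<n)
                             (InB-descent (b i) d (subst (λ q → InB la (q * n + i)) (sym bi+d≡q) bead)))

    level-zero : b 0 ≡ 0
    level-zero with b 0 | proj₂ (levels 0 (ℕ.>-nonZero⁻¹ n))
    ... | zero  | _        = refl
    ... | suc _ | below-b0 = ⊥-elim (0∉B (below-b0 0 z<s))

    length≡sum-levels : ℓ ≡ sumℕ (map b (upTo n))
    length≡sum-levels = trans (sym (List.length-applyUpTo H ℓ))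
      (length≡sum-of-runner-sizes n b hooks hooks-descending
        (λ {x} x∈ → InB⇒<level (m%n<n x n) (subst (InB la) (m≡m/n*n+m%n n x) (∈hooks⇒InB x∈)))
        (λ {q} {i} i<n q<b → InB⇒∈hooks (proj₂ (levels i i<n) q q<b)))

  module BeadPositions (n : ℕ) (b : ℕ → ℕ) where

    bead : ℕ → ℕ
    bead i = b i * n + i

    positions : List ℕ
    positions = pList n b

    private
      positions↭ : positions ↭ map bead (upTo n)
      positions↭ = sort-↭ (map bead (upTo n))

    length-positions : length positions ≡ n
    length-positions = trans (Perm.↭-length positions↭) (trans (List.length-map bead (upTo n)) (List.length-upTo n))

    positions-monotone : ∀ {t t'} → t ≤ t' → t' < n → nth positions t ≤ nth positions t'
    positions-monotone t≤t' t'<n = Linked⇒nth-monotone (sort-↗ (map bead (upTo n))) t≤t'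
      (subst (_ <_) (sym length-positions) t'<n)

    bead∈positions : ∀ {i} → i < n → bead i ∈ positions
    bead∈positions i<n = Perm.∈-resp-↭ (↭-sym positions↭) (∈-map⁺ bead (∈-applyUpTo⁺ (λ t → t) i<n))

    nth-positions : ∀ {t} → t < n → ∃ λ i → i < n × nth positions t ≡ bead i
    nth-positions t<n
      with ∈-map⁻ bead (Perm.∈-resp-↭ positions↭ (nth-∈ positions (subst (_ <_) (sym length-positions) t<n)))
    ... | i , i∈upTo , eq with ∈-applyUpTo⁻ (λ t → t) i∈upTo
    ...   | _ , i<n , refl = i , i<n , eq

    position-of-bead : ∀ {i} → i < n → ∃ λ t → t < n × nth positions t ≡ bead i
    position-of-bead i<n with ∈⇒nth positions (bead∈positions i<n)
    ... | t , t<ℓ , eq = t , subst (_ <_) length-positions t<ℓ , eq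

    sum-over-positions : ∀ (g : ℕ → ℕ) →
                         sumℕ (applyUpTo (λ t → g (nth positions t)) n) ≡ sumℕ (map (λ i → g (bead i)) (upTo n))
    sum-over-positions g = begin
      sumℕ (applyUpTo (λ t → g (nth positions t)) n)
        ≡⟨ cong (λ L → sumℕ (applyUpTo (λ t → g (nth positions t)) L)) length-positions ⟨
      sumℕ (applyUpTo (λ t → g (nth positions t)) (length positions))
        ≡⟨ cong sumℕ (applyUpTo-nth g positions) ⟩
      sumℕ (map g positions)
        ≡⟨ sum-↭ (Perm.map⁺ g positions↭) ⟩
      sumℕ (map g (map bead (upTo n)))
        ≡⟨ cong sumℕ (List.map-∘ (upTo n)) ⟨
      sumℕ (map (λ i → g (bead i)) (upTo n)) ∎
      where open ≡-Reasoning

  ⊓-uncapped : ∀ {u m} → u ⊓ m < m → u ⊓ m ≡ u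
  ⊓-uncapped {u} {m} u⊓m<m with ≤-total u m
  ... | inj₁ u≤m = m≤n⇒m⊓n≡m u≤m
  ... | inj₂ m≤u = ⊥-elim (<-irrefl (m≥n⇒m⊓n≡n m≤u) u⊓m<m)

  -m<+k : ∀ {m k} → 1 ≤ m → ℤ.- (+ m) ℤ.< + k
  -m<+k {suc m} _ = ℤ.-<+

  ip-split : ∀ (y : Point) i j k → ip y i j ℚ.+ ip y (suc j) k ≡ ip y i k
  ip-split y i j k = telescope (y i) (y (suc j)) (y (suc k))
    where
    open +-*-Solver
    telescope : ∀ a b c → (a ℚ.- b) ℚ.+ (b ℚ.- c) ≡ a ℚ.- c
    telescope = solve 3 (λ a b c → (a :- b) :+ (b :- c) := a :- c) refl

  ip-scale : ∀ ε (x : Point) i j → ip (λ t → ε ℚ.* x t) i j ≡ ε ℚ.* ip x i j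
  ip-scale ε x i j = distrib ε (x i) (x (suc j))
    where
    open +-*-Solver
    distrib : ∀ e a b → e ℚ.* a ℚ.- e ℚ.* b ≡ e ℚ.* (a ℚ.- b)
    distrib = solve 3 (λ e a b → e :* a :- e :* b := e :* (a :- b)) refl

  sumℚ-map-scale : ∀ ε (f : ℕ → ℚ) xs → sumℚ (map (λ i → ε ℚ.* f i) xs) ≡ ε ℚ.* sumℚ (map f xs)
  sumℚ-map-scale ε f []       = sym (ℚP.*-zeroʳ ε)
  sumℚ-map-scale ε f (x ∷ xs) =
    trans (cong (λ s → ε ℚ.* f x ℚ.+ s) (sumℚ-map-scale ε f xs)) (sym (ℚP.*-distribˡ-+ ε (f x) _))

  1/[1+k]*[1+k]≡1 : ∀ k → (+ 1 ℚ./ suc k) ℚ.* ℤ→ℚ (+ suc k) ≡ ℚ.1ℚ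
  1/[1+k]*[1+k]≡1 k = ℚP.toℚᵘ-injective (ℚᵘP.≃-trans (ℚP.toℚᵘ-homo-* (+ 1 ℚ./ suc k) (ℤ→ℚ (+ suc k)))
    (ℚᵘP.≃-trans (ℚᵘP.*-cong (ℚP.toℚᵘ-fromℚᵘ (mkℚᵘ (+ 1) k)) (ℤ→ℚ-toℚᵘ (+ suc k)))
      (ℚᵘ.*≡* (trans (ℤP.*-identityʳ _) (trans (ℤP.*-identityˡ _)
        (trans (cong +_ (sym (*-identityʳ (suc k)))) (sym (ℤP.*-identityˡ _))))))))

  module ShrunkAlcovePoint (θ : ℕ) (K : ℕ → ℕ → ℕ) (x : Point) (x∈A : InAlcove (suc θ) (λ i j → + K i j) x) where

    ε : ℚ
    ε = + 1 ℚ./ suc (K 1 θ)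

    instance
      ε-positive : ℚ.Positive ε
      ε-positive = ℚP.normalize-pos 1 (suc (K 1 θ))

    point : Point
    point t = ε ℚ.* x t

    point∈A₀ : 1 ≤ θ → InA0 (suc θ) point
    point∈A₀ 1≤θ = in-V , below-1 , positive
      where
      in-V : InV (suc θ) point
      in-V = trans (sumℚ-map-scale ε x (range 1 (suc θ))) (trans (cong (ε ℚ.*_) (proj₁ x∈A)) (ℚP.*-zeroʳ ε))
      below-1 : ip point 1 θ ℚ.< ℚ.1ℚ
      below-1 = subst₂ ℚ._<_ (sym (ip-scale ε x 1 θ)) (1/[1+k]*[1+k]≡1 (K 1 θ))
        (ℚP.*-monoʳ-<-pos ε (subst (λ q → ip x 1 θ ℚ.< ℤ→ℚ (+ q)) (+-comm (K 1 θ) 1)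
          (proj₂ (proj₂ x∈A 1 θ (≤-refl , 1≤θ , n<1+n θ)))))
      positive : ∀ i → 1 ≤ i → i < suc θ → ℚ.0ℚ ℚ.< ip point i i
      positive i 1≤i i<n = subst₂ ℚ._<_ (ℚP.*-zeroʳ ε) (sym (ip-scale ε x i i))
        (ℚP.*-monoʳ-<-pos ε (ℚP.≤-<-trans (ℤ→ℚ-mono-≤ {+ 0} {+ K i i} (+≤+ z≤n))
          (proj₁ (proj₂ x∈A i i (1≤i , ≤-refl , i<n)))))

  module AlcoveInRegion (θ m : ℕ) (σ : SignVec) (K : ℕ → ℕ → ℕ) (x : Point)
                        (x∈A : InAlcove (suc θ) (λ i j → + K i j) x) (x∈R : InRegion (suc θ) m σ x) where

    σ≡true : ∀ {i j k} → IsShiHyp (suc θ) m i j k → k ℤ.≤ + K i j → σ i j k ≡ true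
    σ≡true {i} {j} {k} hyp k≤K with σ i j k | proj₂ x∈R i j k hyp
    ... | true  | _       = refl
    ... | false | x<k     =
          ⊥-elim (ℤP.<⇒≱ (ℤ→ℚ-cancel-< (ℚP.<-trans (proj₁ (proj₂ x∈A i j (proj₁ hyp))) x<k)) k≤K)

    σ≡false : ∀ {i j k} → IsShiHyp (suc θ) m i j k → + K i j ℤ.< k → σ i j k ≡ false
    σ≡false {i} {j} {k} hyp K<k with σ i j k | proj₂ x∈R i j k hyp
    ... | false | _       = refl
    ... | true  | k<x     = ⊥-elim (ℤP.<⇒≱ (ℤ→ℚ-cancel-< (ℚP.<-trans k<x (proj₂ (proj₂ x∈A i j (proj₁ hyp)))))
                                   (subst (ℤ._≤ k) (ℤP.+-comm (+ 1) (+ K i j)) (ℤP.i<j⇒suc[i]≤j K<k)))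

    sum-σ-indicators≡K : ∀ {i j} → 1 ≤ m → IsRoot (suc θ) i j → K i j ≤ m →
              sumℕ (map (λ k → indicator (σ i j (+ k))) (range 1 m)) ≡ K i j
    sum-σ-indicators≡K {i} {j} 1≤m root K≤m = trans (cong sumℕ (List.map-applyUpTo suc (λ k → indicator (σ i j (+ k))) m))
      (sum-applyUpTo-indicator (λ t → indicator (σ i j (+ suc t))) K≤m
        (λ t t<m t<K → cong indicator (σ≡true (hyperplane t<m) (+≤+ t<K)))
        (λ t t<m K≤t → cong indicator (σ≡false (hyperplane t<m) (+<+ (s≤s K≤t)))))
      where
      hyperplane : ∀ {t} → t < m → IsShiHyp (suc θ) m i j (+ suc t)
      hyperplane t<m = root , -m<+k 1≤m , +≤+ t<m

    m≤K-of-separating-θ-wall : 1 ≤ θ → 1 ≤ m → Separates (suc θ) m σ 1 θ (+ m) → m ≤ K 1 θ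
    m≤K-of-separating-θ-wall 1≤θ 1≤m (inj₁ (R-above , _)) =
      ≤-pred (subst (m <_) (+-comm (K 1 θ) 1) (ℤ→ℚ-cancel-<ₙ
        (ℚP.≤-<-trans (R-above x x∈R) (proj₂ (proj₂ x∈A 1 θ (≤-refl , 1≤θ , n<1+n θ))))))
    m≤K-of-separating-θ-wall 1≤θ 1≤m (inj₂ (_ , A₀-above)) = ⊥-elim (<⇒≱ (ℤ→ℚ-cancel-<ₙ
      (ℚP.≤-<-trans (A₀-above point (point∈A₀ 1≤θ)) (proj₁ (proj₂ (point∈A₀ 1≤θ))))) 1≤m)
      where open ShrunkAlcovePoint θ K x x∈A

    -- On the wall ⟨y,θ⟩ = ⟨y,α_{1j}⟩ + ⟨y,α_{j+1,θ}⟩ = m; the coordinates are capped at m so that the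
    -- hyperplanes used belong to the arrangement.
    θ-wall-gap : 1 ≤ m → IsWall (suc θ) m σ 1 θ (+ m) → ∀ {j} → 1 ≤ j → j < θ → K 1 j + K (suc j) θ < m
    θ-wall-gap 1≤m (_ , y , _ , y-on-wall , y-beside) {j} 1≤j j<θ =
      subst₂ (λ a c → a + c < m) (⊓-uncapped (≤-<-trans (m≤m+n a c) a+c<m))
                                 (⊓-uncapped (≤-<-trans (m≤n+m c a) a+c<m)) a+c<m
      where
      a c : ℕ
      a = K 1 j ⊓ m
      c = K (suc j) θ ⊓ m
      first : IsShiHyp (suc θ) m 1 j (+ a)
      first = (≤-refl , 1≤j , <-trans j<θ (n<1+n θ)) , -m<+k 1≤m , +≤+ (m⊓n≤n _ m)
      second : IsShiHyp (suc θ) m (suc j) θ (+ c)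
      second = (s≤s z≤n , j<θ , n<1+n θ) , -m<+k 1≤m , +≤+ (m⊓n≤n _ m)
      a<y : ℤ→ℚ (+ a) ℚ.< ip y 1 j
      a<y = subst (λ side → OnSide side (ip y 1 j) (+ a)) (σ≡true first (+≤+ (m⊓n≤m _ m)))
        (y-beside 1 j (+ a) first λ (_ , j≡θ , _) → <-irrefl j≡θ j<θ)
      c<y : ℤ→ℚ (+ c) ℚ.< ip y (suc j) θ
      c<y = subst (λ side → OnSide side (ip y (suc j) θ) (+ c)) (σ≡true second (+≤+ (m⊓n≤m _ m)))
        (y-beside (suc j) θ (+ c) second λ (1+j≡1 , _) → <-irrefl (sym (suc-injective 1+j≡1)) 1≤j)
      a+c<m : a + c < m
      a+c<m = ℤ→ℚ-cancel-<ₙ (subst₂ ℚ._<_ (sym (ℤ→ℚ-homo-+ (+ a) (+ c))) (trans (ip-split y 1 j θ) y-on-wall)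
        (ℚP.+-mono-< a<y c<y))

  IsRoot-2⇒ : ∀ {i j} → IsRoot 2 i j → i ≡ 1 × j ≡ 1
  IsRoot-2⇒ (1≤i , i≤j , j<2) =
    ≤-antisym (≤-trans i≤j (≤-pred j<2)) 1≤i , ≤-antisym (≤-pred j<2) (≤-trans 1≤i i≤j)

  module DimensionTwo (m : ℕ) where

    w : ℚ
    w = ℤ→ℚ (+ m) ℚ.+ ℚ.½

    h : ℚ
    h = w ℚ.* ℚ.½

    point : Point
    point 1 = h
    point 2 = ℚ.- h
    point _ = ℚ.0ℚ

    ip-point≡w : ip point 1 1 ≡ w
    ip-point≡w = begin
      h ℚ.- (ℚ.- h)  ≡⟨ double-negation h ⟩
      h ℚ.+ h        ≡⟨ ℚP.*-distribˡ-+ w ℚ.½ ℚ.½ ⟨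
      w ℚ.* ℚ.1ℚ     ≡⟨ ℚP.*-identityʳ w ⟩
      w              ∎
      where
      open ≡-Reasoning
      open +-*-Solver
      double-negation : ∀ a → a ℚ.- (ℚ.- a) ≡ a ℚ.+ a
      double-negation = solve 1 (λ a → a :- (:- a) := a :+ a) refl

    point∈alcove : InAlcove 2 (λ _ _ → + m) point
    point∈alcove = in-V , λ i j root →
      subst₂ (λ i j → ℤ→ℚ (+ m) ℚ.< ip point i j × ip point i j ℚ.< ℤ→ℚ (+ m ℤ.+ + 1))
        (sym (proj₁ (IsRoot-2⇒ root))) (sym (proj₂ (IsRoot-2⇒ root))) (m<w , w<m+1)
      where
      in-V : InV 2 point
      in-V = trans (cong (h ℚ.+_) (ℚP.+-identityʳ (ℚ.- h))) (ℚP.+-inverseʳ h)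
      m<w : ℤ→ℚ (+ m) ℚ.< ip point 1 1
      m<w = subst₂ ℚ._<_ (ℚP.+-identityʳ (ℤ→ℚ (+ m))) (sym ip-point≡w)
        (ℚP.+-monoʳ-< (ℤ→ℚ (+ m)) (ℚ.*<* (+<+ z<s)))
      w<m+1 : ip point 1 1 ℚ.< ℤ→ℚ (+ m ℤ.+ + 1)
      w<m+1 = subst₂ ℚ._<_ (sym ip-point≡w) (sym (ℤ→ℚ-homo-+ (+ m) (+ 1)))
        (ℚP.+-monoʳ-< (ℤ→ℚ (+ m)) (ℚ.*<* (+<+ (s≤s (s≤s z≤n)))))

  -- For n = 2 there is no middle root and the wall says nothing; instead, if K₁₁ > m then the alcove
  -- with coordinate m also lies in R and is closer to A₀.
  minimal-alcove⇒θ-coordinate≤m-in-dimension-two : ∀ {m σ} (K : ℕ → ℕ → ℕ) →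
    IsMinimalAlcove 2 m σ (λ i j → + K i j) → K 1 1 ≤ m
  minimal-alcove⇒θ-coordinate≤m-in-dimension-two {m} {σ} K ((x , x∈A) , A⊆R , minimal) = ≮⇒≥ λ m<K →
    <⇒≱ m<K (subst₂ _≤_ (trans (+-identityʳ _) (+-identityʳ _)) (trans (+-identityʳ _) (+-identityʳ _))
      (minimal (λ _ _ → + m) (point , point∈alcove) (λ z z∈A → proj₁ z∈A , z-beside m<K z z∈A)))
    where
    open DimensionTwo m
    open AlcoveInRegion 1 m σ K x x∈A (A⊆R x x∈A)
    z-beside : m < K 1 1 → ∀ z → InAlcove 2 (λ _ _ → + m) z →
               ∀ i j k → IsShiHyp 2 m i j k → OnSide (σ i j k) (ip z i j) k
    z-beside m<K z z∈A i j k hyp@(root , _ , k≤m) with IsRoot-2⇒ root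
    ... | refl , refl = subst (λ side → OnSide side (ip z 1 1) k) (sym (σ≡true hyp (ℤP.≤-trans k≤m (+≤+ (<⇒≤ m<K)))))
                          (ℚP.≤-<-trans (ℤ→ℚ-mono-≤ k≤m) (proj₁ (proj₂ z∈A 1 1 root)))

  ∸-telescope : ∀ {m n o} → o ≤ n → n ≤ m → (n ∸ o) + (m ∸ n) ≡ m ∸ o
  ∸-telescope {m} {n} {o} o≤n n≤m = +-cancelʳ-≡ o _ _ (begin
    n ∸ o + (m ∸ n) + o   ≡⟨ swap (n ∸ o) (m ∸ n) o ⟩
    m ∸ n + (n ∸ o + o)   ≡⟨ cong (λ u → m ∸ n + u) (m∸n+n≡m o≤n) ⟩
    m ∸ n + n             ≡⟨ m∸n+n≡m n≤m ⟩
    m                     ≡⟨ m∸n+n≡m (≤-trans o≤n n≤m) ⟨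
    m ∸ o + o             ∎)
    where
    open ≡-Reasoning
    swap : ∀ a b c → a + b + c ≡ b + (a + c)
    swap = solve-∀

  Ψℕ : ℕ → (ℕ → ℕ) → ℕ → ℕ → ℕ
  Ψℕ n b i j = floorDiv (p n b (suc j) ∸ p n b i) n

  Ψℕ-subadditive : ∀ k b → let n = suc (suc (suc k)) in
                   Ψℕ n b 1 (suc (suc k)) ≤ suc (Ψℕ n b 1 1 + Ψℕ n b 2 (suc (suc k)))
  Ψℕ-subadditive k b = subst (λ u → u / n ≤ suc ((P 1 ∸ P 0) / n + (P θ ∸ P 1) / n))
    (∸-telescope p₀≤p₁ p₁≤pθ) (/-subadditive n (P 1 ∸ P 0) (P θ ∸ P 1))
    where
    n θ : ℕ
    n = suc (suc (suc k))
    θ = suc (suc k)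
    open BeadPositions n b
    P : ℕ → ℕ
    P = nth positions
    p₀≤p₁ : P 0 ≤ P 1
    p₀≤p₁ = positions-monotone z≤n (s≤s (s≤s z≤n))
    p₁≤pθ : P 1 ≤ P θ
    p₁≤pθ = positions-monotone (s≤s z≤n) (n<1+n θ)

  Ψℕ-θ≤m : ∀ k b {m σ} → 1 ≤ m → let n = suc (suc k) in
    IsWall n m σ 1 (suc k) (+ m) → IsMinimalAlcove n m σ (Ψcoord n b) → Ψℕ n b 1 (suc k) ≤ m
  Ψℕ-θ≤m zero    b _ _ minimal = minimal-alcove⇒θ-coordinate≤m-in-dimension-two (Ψℕ 2 b) minimal
  Ψℕ-θ≤m (suc k) b {m} {σ} 1≤m wall ((x , x∈A) , A⊆R , _) =
    ≤-trans (Ψℕ-subadditive k b) (θ-wall-gap 1≤m wall ≤-refl (s≤s (s≤s z≤n)))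
    where open AlcoveInRegion (suc (suc k)) m σ (Ψℕ (suc (suc (suc k))) b) x x∈A (A⊆R x x∈A)

  module CoreRegion (k m′ : ℕ) (la : List ℕ) (partition : IsPartition la) (core : IsCore (suc (suc k)) la)
                    (b : ℕ → ℕ) (levels : LevelNumbers (suc (suc k)) la b) (σ : SignVec)
                    (minimal : IsMinimalAlcove (suc (suc k)) (suc m′) σ (Ψcoord (suc (suc k)) b))
                    (θ-wall : IsSeparatingWall (suc (suc k)) (suc m′) σ 1 (suc k) (+ suc m′)) where

    n θ m : ℕ
    n = suc (suc k)
    θ = suc k
    m = suc m′

    open Abacus n la partition core b levels
    open BeadPositions n b

    K : ℕ → ℕ → ℕ
    K = Ψℕ n b

    x : Point
    x = proj₁ (proj₁ minimal)

    x∈Ψ : InAlcove n (Ψcoord n b) x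
    x∈Ψ = proj₂ (proj₁ minimal)

    open AlcoveInRegion θ m σ K x x∈Ψ (proj₁ (proj₂ minimal) x x∈Ψ)

    P : ℕ → ℕ
    P = nth positions

    1<n : 1 < n
    1<n = s≤s (s≤s z≤n)

    bead₀≡0 : bead 0 ≡ 0
    bead₀≡0 = cong (λ q → q * n + 0) level-zero

    bead-between-P₀-Pθ : ∀ {i} → i < n → P 0 ≤ bead i × bead i ≤ P θ
    bead-between-P₀-Pθ i<n with position-of-bead i<n
    ... | t , t<n , Pt≡bead = subst (P 0 ≤_) Pt≡bead (positions-monotone z≤n t<n) ,
                              subst (_≤ P θ) Pt≡bead (positions-monotone (≤-pred t<n) (n<1+n θ))

    P₀≡0 : P 0 ≡ 0
    P₀≡0 = n≤0⇒n≡0 (subst (P 0 ≤_) bead₀≡0 (proj₁ (bead-between-P₀-Pθ z<s)))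

    K-first-row : ∀ j → K 1 j ≡ P j / n
    K-first-row j = cong (λ u → (P j ∸ u) / n) P₀≡0

    K-θ≡m : K 1 θ ≡ m
    K-θ≡m = ≤-antisym upper lower
      where
      upper : K 1 θ ≤ m
      upper = Ψℕ-θ≤m k b (s≤s z≤n) (proj₁ θ-wall) minimal
      lower : m ≤ K 1 θ
      lower = m≤K-of-separating-θ-wall (s≤s z≤n) (s≤s z≤n) (proj₂ θ-wall)

    Pθ/n≡m : P θ / n ≡ m
    Pθ/n≡m = trans (sym (K-first-row θ)) K-θ≡m

    K≤m : ∀ i {j} → j < n → K i j ≤ m
    K≤m i {j} j<n = begin
      (P j ∸ P (i ∸ 1)) / n  ≤⟨ /-monoˡ-≤ n (≤-trans (m∸n≤m (P j) (P (i ∸ 1)))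
                                              (positions-monotone (≤-pred j<n) (n<1+n θ))) ⟩
      P θ / n                ≡⟨ Pθ/n≡m ⟩
      m                      ∎
      where open ≤-Reasoning

    level-of-top-bead : ∀ {i} → i < n → P θ ≡ bead i → b i ≡ m
    level-of-top-bead {i} i<n Pθ≡bead = trans (sym ([q*n+i]/n≡q n (b i) i<n)) (trans (cong (_/ n) (sym Pθ≡bead)) Pθ/n≡m)

    -- Were the top bead on a runner i ≥ 2, bead 1 would sit at a middle position t where the
    -- coordinates K 1 t and K (suc t) θ add up to b i = m, against θ-wall-gap.
    bead₁-below-middle-top-bead : ∀ {i t} → 2 ≤ i → i < n → P θ ≡ bead i → t < n → P t ≢ bead 1
    bead₁-below-middle-top-bead {i} {t} 2≤i i<n Pθ≡bead t<n Pt≡bead₁ =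
      <-irrefl K-sum≡m (θ-wall-gap (s≤s z≤n) (proj₁ θ-wall) 1≤t t<θ)
      where
      1≤t : 1 ≤ t
      1≤t = n≢0⇒n>0 λ t≡0 → 0≢1+n (begin
        0                ≡⟨ P₀≡0 ⟨
        P 0              ≡⟨ cong P t≡0 ⟨
        P t              ≡⟨ Pt≡bead₁ ⟩
        b 1 * n + 1      ≡⟨ +-comm (b 1 * n) 1 ⟩
        suc (b 1 * n)    ∎)
        where open ≡-Reasoning
      t<θ : t < θ
      t<θ = ≤∧≢⇒< (≤-pred t<n) λ t≡θ → <-irrefl (begin
        1                ≡⟨ [q*n+i]%n≡i n (b 1) 1<n ⟨
        bead 1 % n       ≡⟨ cong (_% n) (trans (sym Pt≡bead₁) (trans (cong P t≡θ) Pθ≡bead)) ⟩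
        bead i % n       ≡⟨ [q*n+i]%n≡i n (b i) i<n ⟩
        i                ∎) 2≤i
        where open ≡-Reasoning
      b₁≤bᵢ : b 1 ≤ b i
      b₁≤bᵢ = subst₂ _≤_ ([q*n+i]/n≡q n (b 1) 1<n) ([q*n+i]/n≡q n (b i) i<n)
        (/-monoˡ-≤ n (subst (bead 1 ≤_) Pθ≡bead (proj₂ (bead-between-P₀-Pθ 1<n))))
      K-sum≡m : K 1 t + K (suc t) θ ≡ m
      K-sum≡m = begin
        K 1 t + K (suc t) θ                  ≡⟨ cong₂ _+_ (trans (K-first-row t) (cong (_/ n) Pt≡bead₁))
                                                          (cong₂ (λ u v → (u ∸ v) / n) Pθ≡bead Pt≡bead₁) ⟩
        bead 1 / n + (bead i ∸ bead 1) / n   ≡⟨ cong₂ _+_ ([q*n+i]/n≡q n (b 1) 1<n)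
                                                          ([a*n+i∸[c*n+j]]/n≡a∸c n b₁≤bᵢ (≤-trans (n≤1+n 1) 2≤i) i<n) ⟩
        b 1 + (b i ∸ b 1)                    ≡⟨ m+[n∸m]≡n b₁≤bᵢ ⟩
        b i                                  ≡⟨ level-of-top-bead i<n Pθ≡bead ⟩
        m                                    ∎
        where open ≡-Reasoning

    middle-bead-not-on-top : ∀ {i} → 2 ≤ i → i < n → P θ ≢ bead i
    middle-bead-not-on-top 2≤i i<n Pθ≡bead =
      let (t , t<n , Pt≡bead₁) = position-of-bead 1<n in bead₁-below-middle-top-bead 2≤i i<n Pθ≡bead t<n Pt≡bead₁

    top-bead-is-bead₁ : ∀ {i} → i < n → P θ ≡ bead i → P θ ≡ bead 1
    top-bead-is-bead₁ {zero}        _   Pθ≡bead₀ =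
      ⊥-elim (1+n≢0 (trans (sym (level-of-top-bead z<s Pθ≡bead₀)) level-zero))
    top-bead-is-bead₁ {suc zero}    _   Pθ≡bead₁ = Pθ≡bead₁
    top-bead-is-bead₁ {suc (suc i)} i<n Pθ≡beadᵢ = ⊥-elim (middle-bead-not-on-top (s≤s (s≤s z≤n)) i<n Pθ≡beadᵢ)

    top-bead : P θ ≡ bead 1
    top-bead = let (_ , i<n , Pθ≡beadᵢ) = nth-positions (n<1+n θ) in top-bead-is-bead₁ i<n Pθ≡beadᵢ

    level-one : b 1 ≡ m
    level-one = level-of-top-bead 1<n top-bead

    Pθ≡m*n+1 : P θ ≡ m * n + 1
    Pθ≡m*n+1 = trans top-bead (cong (λ q → q * n + 1) level-one)

    level≤m′ : ∀ {i} → 2 ≤ i → i < n → b i ≤ m′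
    level≤m′ {i} 2≤i i<n = ≤-pred (≰⇒> λ m≤bᵢ → <⇒≱ (begin-strict
      m * n + 1     <⟨ +-monoʳ-< (m * n) 2≤i ⟩
      m * n + i     ≤⟨ +-monoˡ-≤ i (*-monoˡ-≤ n m≤bᵢ) ⟩
      bead i        ∎) (subst (bead i ≤_) Pθ≡m*n+1 (proj₂ (bead-between-P₀-Pθ i<n))))
      where open ≤-Reasoning

    Rb Rc : ℕ
    Rb = sumℕ (map b (range 2 θ))
    Rc = sumℕ (map (λ i → m′ ∸ b i) (range 2 θ))

    sum-levels≡m+Rb : sumℕ (map b (upTo n)) ≡ m + Rb
    sum-levels≡m+Rb = cong₂ (λ u v → u + (v + Rb)) level-zero level-one

    length≡m+Rb : ℓ ≡ m + Rb
    length≡m+Rb = trans length≡sum-levels sum-levels≡m+Rb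

    rStat≡m+Rb : rStat n m σ ≡ m + Rb
    rStat≡m+Rb = begin
      rStat n m σ
        ≡⟨ cong sumℕ (map-applyUpTo-cong suc θ row) ⟩
      sumℕ (map (K 1) (range 1 θ))
        ≡⟨ cong sumℕ (trans (List.map-cong K-first-row (range 1 θ)) (List.map-applyUpTo suc (λ j → P j / n) θ)) ⟩
      0 + sumℕ (applyUpTo (λ t → P (suc t) / n) θ)
        ≡⟨ cong (λ u → u / n + sumℕ (applyUpTo (λ t → P (suc t) / n) θ)) P₀≡0 ⟨
      sumℕ (applyUpTo (λ t → P t / n) n)
        ≡⟨ sum-over-positions (_/ n) ⟩
      sumℕ (map (λ i → bead i / n) (upTo n))
        ≡⟨ cong sumℕ (map-applyUpTo-cong (λ i → i) n λ {i} i<n → [q*n+i]/n≡q n (b i) i<n) ⟩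
      sumℕ (map b (upTo n))
        ≡⟨ sum-levels≡m+Rb ⟩
      m + Rb ∎
      where
      open ≡-Reasoning
      row : ∀ {t} → t < θ → sumℕ (map (λ k → indicator (σ 1 (suc t) (+ k))) (range 1 m)) ≡ K 1 (suc t)
      row t<θ = sum-σ-indicators≡K (s≤s z≤n) (≤-refl , s≤s z≤n , s≤s t<θ) (K≤m 1 (s≤s t<θ))

    cStat≡m+Rc : cStat n m σ ≡ m + Rc
    cStat≡m+Rc = begin
      cStat n m σ
        ≡⟨ cong sumℕ (map-applyUpTo-cong suc θ column) ⟩
      sumℕ (map (λ i → K i θ) (range 1 θ))
        ≡⟨ cong sumℕ (List.map-applyUpTo suc (λ i → K i θ) θ) ⟩
      sumℕ (applyUpTo (λ t → (P θ ∸ P t) / n) θ)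
        ≡⟨ +-identityʳ _ ⟨
      sumℕ (applyUpTo (λ t → (P θ ∸ P t) / n) θ) + 0
        ≡⟨ cong (λ u → sumℕ (applyUpTo (λ t → (P θ ∸ P t) / n) θ) + u / n) (n∸n≡0 (P θ)) ⟨
      sumℕ (applyUpTo (λ t → (P θ ∸ P t) / n) θ) + (P θ ∸ P θ) / n
        ≡⟨ sum-applyUpTo-suc (λ t → (P θ ∸ P t) / n) θ ⟨
      sumℕ (applyUpTo (λ t → (P θ ∸ P t) / n) n)
        ≡⟨ sum-over-positions (λ p → (P θ ∸ p) / n) ⟩
      sumℕ (map (λ i → (P θ ∸ bead i) / n) (upTo n))
        ≡⟨ cong₂ (λ u v → u + (v + sumℕ (map (λ i → (P θ ∸ bead i) / n) (range 2 θ)))) column₀ column₁ ⟩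
      m + sumℕ (map (λ i → (P θ ∸ bead i) / n) (range 2 θ))
        ≡⟨ cong (λ s → m + sumℕ s) (map-applyUpTo-cong (λ t → 2 + t) k λ t<k → columnᵢ (s≤s (s≤s t<k))) ⟩
      m + Rc ∎
      where
      open ≡-Reasoning
      column : ∀ {t} → t < θ → sumℕ (map (λ k → indicator (σ (suc t) θ (+ k))) (range 1 m)) ≡ K (suc t) θ
      column {t} t<θ = sum-σ-indicators≡K (s≤s z≤n) (s≤s z≤n , t<θ , n<1+n θ) (K≤m (suc t) (n<1+n θ))
      column₀ : (P θ ∸ bead 0) / n ≡ m
      column₀ = trans (cong (λ u → (P θ ∸ u) / n) bead₀≡0) Pθ/n≡m
      column₁ : (P θ ∸ bead 1) / n ≡ 0
      column₁ = trans (cong (λ u → (u ∸ bead 1) / n) top-bead) (cong (_/ n) (n∸n≡0 (bead 1)))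
      columnᵢ : ∀ {i} → 2 + i < n → (P θ ∸ bead (2 + i)) / n ≡ m′ ∸ b (2 + i)
      columnᵢ {i} i<n = trans (cong (λ u → (u ∸ bead (2 + i)) / n) Pθ≡m*n+1)
        ([a*n+i∸[c*n+j]]/n≡a∸suc-c n (s≤s (level≤m′ (s≤s (s≤s z≤n)) i<n)) (s≤s (s≤s z≤n)) i<n)

    bead≤top : ∀ {x} → InB la x → x ≤ m′ * n + 1
    bead≤top {x} x∈B = subst (_≤ m′ * n + 1) (sym (m≡m/n*n+m%n n x))
      (runner-top {x / n} (m%n<n x n) (InB⇒<level (m%n<n x n) (subst (InB la) (m≡m/n*n+m%n n x) x∈B)))
      where
      runner-top : ∀ {q r} → r < n → q < b r → q * n + r ≤ m′ * n + 1
      runner-top {q} {zero}        _   q<b₀ = ⊥-elim (n≮0 (subst (q <_) level-zero q<b₀))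
      runner-top {q} {suc zero}    _   q<b₁ = +-monoˡ-≤ 1 (*-monoˡ-≤ n (≤-pred (subst (q <_) level-one q<b₁)))
      runner-top {q} {suc (suc r)} r<n q<b = begin
        q * n + suc (suc r)  ≤⟨ +-monoʳ-≤ (q * n) (<⇒≤ r<n) ⟩
        q * n + n            ≡⟨ +-comm (q * n) n ⟩
        suc q * n            ≤⟨ *-monoˡ-≤ n (<-≤-trans q<b (level≤m′ (s≤s (s≤s z≤n)) r<n)) ⟩
        m′ * n               ≤⟨ m≤m+n (m′ * n) 1 ⟩
        m′ * n + 1           ∎
        where open ≤-Reasoning

    0<ℓ : 0 < ℓ
    0<ℓ = subst (0 <_) (sym length≡m+Rb) z<s

    H₀≡m′*n+1 : H 0 ≡ m′ * n + 1
    H₀≡m′*n+1 with proj₂ (levels 1 1<n) m′ (subst (m′ <_) (sym level-one) (n<1+n m′))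
    ... | t , t<ℓ , Ht≡ = ≤-antisym (bead≤top (0 , 0<ℓ , refl)) (subst (_≤ H 0) Ht≡ (H-antitone z≤n t<ℓ))

    Rb+Rc≡k*m′ : Rb + Rc ≡ k * m′
    Rb+Rc≡k*m′ = begin
      Rb + Rc                                       ≡⟨ sum-map-+ b (λ i → m′ ∸ b i) (range 2 θ) ⟨
      sumℕ (map (λ i → b i + (m′ ∸ b i)) (range 2 θ)) ≡⟨ cong sumℕ (map-applyUpTo-cong (λ t → 2 + t) k λ t<k →
                                                         m+[n∸m]≡n (level≤m′ (s≤s (s≤s z≤n)) (s≤s (s≤s t<k)))) ⟩
      sumℕ (map (λ _ → m′) (range 2 θ))             ≡⟨ sum-map-const m′ (range 2 θ) ⟩
      length (range 2 θ) * m′                       ≡⟨ cong (_* m′) (List.length-applyUpTo (λ t → 2 + t) k) ⟩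
      k * m′                                        ∎
      where open ≡-Reasoning

    largestPart≡m+Rc : largestPart la ≡ m + Rc
    largestPart≡m+Rc = trans (largestPart≡nth-0 la 0<ℓ) (+-cancelʳ-≡ ℓ _ _ (begin
      nth la 0 + ℓ                ≡⟨ H+suc≡part+ℓ 0<ℓ ⟨
      H 0 + 1                     ≡⟨ cong (λ h → h + 1) H₀≡m′*n+1 ⟩
      m′ * n + 1 + 1              ≡⟨ expand m′ k ⟩
      2 + 2 * m′ + k * m′         ≡⟨ cong (λ s → 2 + 2 * m′ + s) Rb+Rc≡k*m′ ⟨
      2 + 2 * m′ + (Rb + Rc)      ≡⟨ regroup m′ Rb Rc ⟨
      (m + Rc) + (m + Rb)         ≡⟨ cong (λ l → m + Rc + l) length≡m+Rb ⟨
      m + Rc + ℓ                  ∎))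
      where
      open ≡-Reasoning
      expand : ∀ m′ k → m′ * suc (suc k) + 1 + 1 ≡ 2 + 2 * m′ + k * m′
      expand = solve-∀
      regroup : ∀ m′ Rb Rc → (suc m′ + Rc) + (suc m′ + Rb) ≡ 2 + 2 * m′ + (Rb + Rc)
      regroup = solve-∀

    sumℤ-levels≡Rb : sumℤ (map (λ i → + b i) (range 2 θ)) ≡ + Rb
    sumℤ-levels≡Rb = sumℤ-map-+≡+-sumℕ b (range 2 θ)

    sumℤ-colevels≡Rc : sumℤ (map (λ i → (+ m ℤ.- + 1) ℤ.- + b i) (range 2 θ)) ≡ + Rc
    sumℤ-colevels≡Rc = trans (cong sumℤ (map-applyUpTo-cong (λ t → 2 + t) k λ {t} t<k →
        trans (ℤP.[+m]-[+n]≡m⊖n m′ (b (2 + t))) (ℤP.⊖-≥ (level≤m′ (s≤s (s≤s z≤n)) (s≤s (s≤s t<k))))))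
      (sumℤ-map-+≡+-sumℕ (λ i → m′ ∸ b i) (range 2 θ))

open ShiCoreStatistics using (module CoreRegion)
open import Data.Nat as ℕ using (ℕ; suc; _≤_; _∸_; s≤s; z≤n)
open import Data.Integer using (ℤ; +_; _+_; _-_)
open import Data.List using (List; map)
open import Data.Product using (_×_; _,_)
open import Relation.Binary.PropositionalEquality using (_≡_; cong; sym; trans)

proposition4p2 :
    (n m : ℕ) → 2 ≤ n → 1 ≤ m →
    (la : List ℕ) → IsPartition la → IsCore n la →
    (b : ℕ → ℕ) → LevelNumbers n la b →
    (σ : SignVec) → IsRegion n m σ → IsDominant n m σ →
    IsMinimalAlcove n m σ (Ψcoord n b) →
    IsSeparatingWall n m σ 1 (n ∸ 1) (+ m) →
    ((+ rStat n m σ ≡ + m + sumℤ (map (λ i → + b i) (range 2 (n ∸ 1))))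
      × (+ m + sumℤ (map (λ i → + b i) (range 2 (n ∸ 1))) ≡ + len la))
    × ((+ cStat n m σ ≡ + m + sumℤ (map (λ i → (+ m - + 1) - + b i) (range 2 (n ∸ 1))))
      × (+ m + sumℤ (map (λ i → (+ m - + 1) - + b i) (range 2 (n ∸ 1))) ≡ + largestPart la))
proposition4p2 .(suc (suc k)) .(suc m′) (s≤s (s≤s {n = k} z≤n)) (s≤s {n = m′} z≤n)
               la partition core b levels σ _ _ minimal θ-wall =
  (trans (cong +_ rStat≡m+Rb) (sym r-sum) , trans r-sum (cong +_ (sym length≡m+Rb))) ,
  (trans (cong +_ cStat≡m+Rc) (sym c-sum) , trans c-sum (cong +_ (sym largestPart≡m+Rc)))
  where
  open CoreRegion k m′ la partition core b levels σ minimal θ-wall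
  r-sum : + m + sumℤ (map (λ i → + b i) (range 2 θ)) ≡ + (m ℕ.+ Rb)
  r-sum = cong (λ s → + m + s) sumℤ-levels≡Rb
  c-sum : + m + sumℤ (map (λ i → (+ m - + 1) - + b i) (range 2 θ)) ≡ + (m ℕ.+ Rc)
  c-sum = cong (λ s → + m + s) sumℤ-colevels≡Rc
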